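{- Let $n\geq 4$ and let $g_0$ be the largest positive integer such that $\frac{3g_0^2-g_0+2}{2g_0}<n$. Let $G$ be a lollipop graph on $n$ vertices, i.e. $G$ is isomorphic to $U_{n,g}^l$ for some $3\leq g<n$. Then $$F(U_{n,3}^l)\leq F(G)\leq F(U_{n,g_0+1}^l),$$ with equality on the left if and only if $G$ is isomorphic to $U_{n,3}^l$, and equality on the right if and only if $G$ is isomorphic to $U_{n,g_0+1}^l$.
   Context: All graphs are finite, simple and undirected. The lollipop graph $U_{n,g}^l$ ($3\leq g<n$) is obtained from the cycle $C_g$ and a path on $n-g+1$ vertices by identifying one end vertex of the path with a vertex of the cycle. A connected subgraph of a graph $G=(V,E)$ is a graph $(V',E')$ with $\emptyset\neq V'\subseteq V$, $E'\subseteq E$, every edge of $E'$ having both endpoints in $V'$, and $(V',E')$ connected; distinct pairs $(V',E')$ are counted separately. The core index $F(G)$ is the number of connected subgraphs of $G$. -}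

module Defs where

open import Data.Nat using (ℕ; zero; suc; _+_; _*_; _∸_; _≤_; _<_; _≡ᵇ_)
open import Data.Bool using (Bool; true; false; _∨_; _∧_)
open import Data.Fin using (Fin; toℕ)
open import Data.Fin.Subset using (Subset) renaming (_∈_ to _∈ₛ_)
open import Data.Fin.Permutation using (Permutation′; _⟨$⟩ʳ_)
open import Data.Vec using (Vec; lookup)
open import Data.List using (List; length)
open import Data.List.Relation.Unary.Unique.Propositional using (Unique)
open import Data.List.Membership.Propositional using () renaming (_∈_ to _∈ₗ_)
open import Data.Product using (Σ; ∃; _×_; _,_)
open import Relation.Binary.PropositionalEquality using (_≡_)
open import Function.Bundles using (_⇔_)

Graph : ℕ → Set
Graph n = Fin n → Fin n → Bool

_≅_ : {n : ℕ} → Graph n → Graph n → Set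
_≅_ {n} G H = Σ (Permutation′ n) λ σ → ∀ i j → G i j ≡ H (σ ⟨$⟩ʳ i) (σ ⟨$⟩ʳ j)

-- Lollipop graph U^l_{n,g} on vertices 0..n-1: the path 0-1-2-...-(n-1)
-- together with the extra edge {0, g-1}. Vertices 0..g-1 form the cycle C_g,
-- and g-1, g, ..., n-1 form the pendant path on n-g+1 vertices.
lolAdjℕ : ℕ → ℕ → ℕ → Bool
lolAdjℕ g a b =
  (suc a ≡ᵇ b) ∨ (suc b ≡ᵇ a) ∨ ((a ≡ᵇ 0) ∧ (b ≡ᵇ (g ∸ 1))) ∨ ((b ≡ᵇ 0) ∧ (a ≡ᵇ (g ∸ 1)))

lollipop : (n g : ℕ) → Graph n
lollipop n g i j = lolAdjℕ g (toℕ i) (toℕ j)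

-- A candidate subgraph (V', E'): a vertex subset and an edge set given as a
-- (symmetric) Boolean matrix; each unordered edge {i,j} corresponds to the
-- two symmetric entries (i,j),(j,i).
Sub : ℕ → Set
Sub n = Subset n × Vec (Vec Bool n) n

entry : {n : ℕ} → Vec (Vec Bool n) n → Fin n → Fin n → Bool
entry E i j = lookup (lookup E i) j

IsSubgraph : {n : ℕ} → Graph n → Sub n → Set
IsSubgraph {n} G (V , E) =
  (∀ i j → entry E i j ≡ entry E j i) ×
  (∀ i j → entry E i j ≡ true → (G i j ≡ true) × (i ∈ₛ V) × (j ∈ₛ V))

data Reach {n : ℕ} (V : Subset n) (E : Vec (Vec Bool n) n) (i : Fin n) : Fin n → Set where
  here : i ∈ₛ V → Reach V E i i
  step : ∀ {j k} → Reach V E i j → entry E j k ≡ true → Reach V E i k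

Connected : {n : ℕ} → Sub n → Set
Connected {n} (V , E) = (∃ λ i → i ∈ₛ V) × (∀ i j → i ∈ₛ V → j ∈ₛ V → Reach V E i j)

ConnSub : {n : ℕ} → Graph n → Sub n → Set
ConnSub G s = IsSubgraph G s × Connected s

CoreIndex : {n : ℕ} → Graph n → ℕ → Set
CoreIndex {n} G k =
  Σ (List (Sub n)) λ L → Unique L × (∀ s → (s ∈ₗ L) ⇔ ConnSub G s) × (length L ≡ k)

-- g satisfies (3g^2 - g + 2)/(2g) < n with g positive, i.e. 3g^2 - g + 2 < 2gn.
G0cond : ℕ → ℕ → Set
G0cond n g = (1 ≤ g) × (3 * g * g + 2 < 2 * g * n + g)

IsG0 : ℕ → ℕ → Set
IsG0 n g₀ = G0cond n g₀ × (∀ g → G0cond n g → g ≤ g₀)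

module Submission where

-- Adding a vertex v to a graph G: a connected subgraph
-- either avoids v or contains it, and the latter are the subgraphs "rooted"
-- at v.  Rooted subgraphs (every vertex joined to a root set S, containing a
-- mark set M) obey recurrences when the new vertex is a root, a pendant
-- vertex, or closes a cycle.  Building U_{n,g} vertex by vertex (a path, the
-- closing vertex, then the pendant path) yields F recursively, with closed
-- form 2F = g(g-1) + k(k+1) + (k+1)(g²+g+2) for k = n - g.  Hence
-- 2F(g+1) - 2F(g) = (2gn + g) - (3g² + 2), positive iff g ≤ g₀ and never 0,
-- while F(n-1) > F(3): the sequence g ↦ F(U_{n,g}) is unimodal with its
-- peak at g₀ + 1 and its minimum at 3.

open import Defs
open import Data.Nat using (ℕ; zero; suc; _+_; _*_; _∸_; _≤_; _<_; z≤n; s≤s; _<?_)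
open import Data.Nat.Properties using (≮⇒≥; <-irrefl; +-mono-≤-<; *-monoʳ-≤; m∸n+n≡m; m∸[m∸n]≡n; n∸n≡0; +-identityʳ; ≤-trans; <-≤-trans)
open import Data.Fin using (Fin; toℕ; opposite)
open import Data.Fin.Properties using (opposite-prop; opposite-involutive; toℕ≤pred[n])
open import Data.Product using (Σ; ∃; _×_; _,_; proj₁; proj₂)
open import Data.Empty using (⊥-elim)
open import Relation.Nullary using (yes; no; ¬_)
open import Relation.Binary.PropositionalEquality using (_≡_; refl; sym; trans; cong; cong₂; subst)
open import Function.Bundles using (_⇔_; mk⇔; Equivalence)

module Counting where

  open import Data.Nat using (ℕ; _+_)
  open import Data.List using (List; []; _∷_; length; map; _++_)
  open import Data.Nat.ListAction using (sum)
  open import Data.List.Properties using (length-map; length-++)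
  open import Data.List.Relation.Unary.Unique.Propositional using (Unique)
  open import Data.List.Relation.Unary.Unique.Propositional.Properties using (map⁺; ++⁺)
  open import Data.List.Relation.Unary.AllPairs using ([]; _∷_)
  open import Data.List.Relation.Unary.Any using (here; there)
  open import Data.List.Relation.Unary.All.Properties using (All¬⇒¬Any)
  open import Data.List.Membership.Propositional using (_∈_)
  open import Data.List.Membership.Propositional.Properties using (∈-map⁺; ∈-map⁻; ∈-++⁺ˡ; ∈-++⁺ʳ; ∈-++⁻)
  open import Data.List.Membership.Propositional.Properties.WithK using (unique∧set⇒bag)
  open import Data.List.Relation.Binary.BagAndSetEquality using (∼bag⇒↭)
  open import Data.List.Relation.Binary.Permutation.Propositional.Properties using (↭-length)
  import Data.List.Relation.Unary.All as All
  open import Data.Product using (∃; Σ; _×_; _,_)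
  open import Data.Sum using (_⊎_; inj₁; inj₂; [_,_])
  open import Data.Empty using (⊥)
  open import Relation.Binary.PropositionalEquality using (_≡_; refl; subst)
  open import Function.Bundles using (_⇔_; mk⇔; Equivalence)

  open Equivalence using (to; from)

  Count : {A : Set} → (A → Set) → ℕ → Set
  Count {A} P k = Σ (List A) λ L → Unique L × (∀ s → (s ∈ L) ⇔ P s) × (length L ≡ k)

  module _ {A : Set} where

    count-⇔ : ∀ {P Q : A → Set} {k} → (∀ s → P s → Q s) → (∀ s → Q s → P s) → Count P k → Count Q k
    count-⇔ f g (L , u , mem , len) =
      L , u , (λ s → mk⇔ (λ i → f s (to (mem s) i)) (λ q → from (mem s) (g s q))) , len

    -- Counts are unique: two duplicate-free enumerations of P are permutations of each other.
    count-unique : ∀ {P : A → Set} {a b} → Count P a → Count P b → a ≡ b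
    count-unique (L₁ , u₁ , mem₁ , refl) (L₂ , u₂ , mem₂ , refl) =
      ↭-length (∼bag⇒↭ (unique∧set⇒bag u₁ u₂ λ {x} →
        mk⇔ (λ i → from (mem₂ x) (to (mem₁ x) i)) (λ i → from (mem₁ x) (to (mem₂ x) i))))

    count-singleton : (x : A) → Count (λ s → s ≡ x) 1
    count-singleton x = (x ∷ []) , (All.[] ∷ []) , (λ s → mk⇔ (λ { (here e) → e ; (there ()) }) here) , refl

    count-empty : Count (λ (_ : A) → ⊥) 0
    count-empty = [] , [] , (λ s → mk⇔ (λ ()) (λ ())) , refl

    count-⊎ : ∀ {P Q : A → Set} {a b} → Count P a → Count Q b → (∀ s → P s → Q s → ⊥) →
              Count (λ s → P s ⊎ Q s) (a + b)
    count-⊎ (L₁ , u₁ , mem₁ , refl) (L₂ , u₂ , mem₂ , refl) disjoint =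
      (L₁ ++ L₂) ,
      ++⁺ u₁ u₂ (λ { (i , j) → disjoint _ (to (mem₁ _) i) (to (mem₂ _) j) }) ,
      (λ s → mk⇔ (λ i → [ (λ i₁ → inj₁ (to (mem₁ s) i₁)) , (λ i₂ → inj₂ (to (mem₂ s) i₂)) ] (∈-++⁻ L₁ i))
                 [ (λ p → ∈-++⁺ˡ (from (mem₁ s) p)) , (λ q → ∈-++⁺ʳ L₁ (from (mem₂ s) q)) ]) ,
      length-++ L₁

    count-⋃ : ∀ {I : Set} {Q : I → A → Set} (is : List I) (k : I → ℕ) → Unique is →
              (∀ {i j s} → Q i s → Q j s → i ≡ j) → (∀ i → Count (Q i) (k i)) →
              Count (λ s → ∃ λ i → i ∈ is × Q i s) (sum (map k is))
    count-⋃ [] k u disjoint counts = count-⇔ (λ _ ()) (λ { s (_ , () , _) }) count-empty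
    count-⋃ {Q = Q} (i ∷ is) k (i∉is ∷ u) disjoint counts =
      count-⇔ join split (count-⊎ (counts i) (count-⋃ is k u disjoint counts) apart)
      where
      apart : ∀ s → Q i s → (∃ λ j → j ∈ is × Q j s) → ⊥
      apart s q (j , j∈is , q′) = All¬⇒¬Any i∉is (subst (_∈ is) (disjoint q′ q) j∈is)
      join : ∀ s → Q i s ⊎ (∃ λ j → j ∈ is × Q j s) → ∃ λ j → j ∈ (i ∷ is) × Q j s
      join s (inj₁ q) = i , here refl , q
      join s (inj₂ (j , j∈is , q)) = j , there j∈is , q
      split : ∀ s → (∃ λ j → j ∈ (i ∷ is) × Q j s) → Q i s ⊎ (∃ λ j → j ∈ is × Q j s)
      split s (j , here refl , q) = inj₁ q
      split s (j , there j∈is , q) = inj₂ (j , j∈is , q)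

  module _ {A B : Set} where

    count-image : ∀ {P : A → Set} {k} (f : A → B) → (∀ {x y} → f x ≡ f y → x ≡ y) → Count P k →
                  Count (λ b → ∃ λ a → P a × b ≡ f a) k
    count-image {P} f f-inj (L , u , mem , refl) =
      map f L , map⁺ f-inj u , (λ b → mk⇔ (image⁺ b) (image⁻ b)) , length-map f L
      where
      image⁺ : ∀ b → b ∈ map f L → ∃ λ a → P a × b ≡ f a
      image⁺ b i with ∈-map⁻ f i
      ... | a , a∈L , b≡fa = a , to (mem a) a∈L , b≡fa
      image⁻ : ∀ b → (∃ λ a → P a × b ≡ f a) → b ∈ map f L
      image⁻ .(f a) (a , p , refl) = ∈-map⁺ f (from (mem a) p)

module Isomorphism where

  open import Defs
  open Counting
  open import Data.Nat using (ℕ)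
  open import Data.Bool using (Bool; true)
  open import Data.Fin using (Fin)
  open import Data.Fin.Subset using (Subset) renaming (_∈_ to _∈ₛ_)
  open import Data.Fin.Permutation using (_⟨$⟩ʳ_; _⟨$⟩ˡ_; inverseˡ; inverseʳ)
  open import Data.Vec using (Vec; lookup; tabulate)
  open import Data.Vec.Properties using (lookup∘tabulate; tabulate∘lookup; tabulate-cong; []=⇒lookup; lookup⇒[]=)
  open import Data.Product using (_×_; _,_)
  open import Relation.Binary.PropositionalEquality using (_≡_; refl; sym; trans; cong; cong₂; subst; subst₂)

  module _ {n : ℕ} where

    pullV : (Fin n → Fin n) → Subset n → Subset n
    pullV f V = tabulate (λ i → lookup V (f i))

    pullE : (Fin n → Fin n) → Vec (Vec Bool n) n → Vec (Vec Bool n) n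
    pullE f E = tabulate (λ i → tabulate (λ j → entry E (f i) (f j)))

    pull : (Fin n → Fin n) → Sub n → Sub n
    pull f (V , E) = pullV f V , pullE f E

    entry-pull : ∀ f E i j → entry (pullE f E) i j ≡ entry E (f i) (f j)
    entry-pull f E i j = trans (cong (λ row → lookup row j) (lookup∘tabulate _ i)) (lookup∘tabulate _ j)

    lookup-pullV : ∀ f V i → lookup (pullV f V) i ≡ lookup V (f i)
    lookup-pullV f V i = lookup∘tabulate (λ i → lookup V (f i)) i

    ∈-pull⁺ : ∀ f V i → f i ∈ₛ V → i ∈ₛ pullV f V
    ∈-pull⁺ f V i m = lookup⇒[]= i (pullV f V) (trans (lookup-pullV f V i) ([]=⇒lookup m))

    ∈-pull⁻ : ∀ f V i → i ∈ₛ pullV f V → f i ∈ₛ V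
    ∈-pull⁻ f V i m = lookup⇒[]= (f i) V (trans (sym (lookup-pullV f V i)) ([]=⇒lookup m))

    pull-pull : (f h : Fin n → Fin n) → (∀ i → f (h i) ≡ i) → ∀ s → pull h (pull f s) ≡ s
    pull-pull f h fh (V , E) = cong₂ _,_ vertices edges
      where
      vertices : pullV h (pullV f V) ≡ V
      vertices = trans (tabulate-cong (λ i → trans (lookup-pullV f V (h i)) (cong (lookup V) (fh i))))
                       (tabulate∘lookup V)
      edges : pullE h (pullE f E) ≡ E
      edges = trans (tabulate-cong (λ i →
                       trans (tabulate-cong (λ j → trans (entry-pull f E (h i) (h j)) (cong₂ (entry E) (fh i) (fh j))))
                             (tabulate∘lookup (lookup E i))))
                    (tabulate∘lookup E)

    reach-pull : (f h : Fin n → Fin n) → (∀ i → f (h i) ≡ i) →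
                 ∀ {V E a b} → Reach V E a b → Reach (pullV f V) (pullE f E) (h a) (h b)
    reach-pull f h fh {V} {a = a} (here a∈V) = here (∈-pull⁺ f V (h a) (subst (_∈ₛ V) (sym (fh a)) a∈V))
    reach-pull f h fh {E = E} (step {j} {k} r e) =
      step (reach-pull f h fh r) (trans (entry-pull f E (h j) (h k)) (subst₂ (λ x y → entry E x y ≡ true) (sym (fh j)) (sym (fh k)) e))

    connSub-pull : (G H : Graph n) (f h : Fin n → Fin n) → (∀ i → f (h i) ≡ i) → (∀ i → h (f i) ≡ i) →
                   (∀ i j → G i j ≡ H (f i) (f j)) → ∀ s → ConnSub H s → ConnSub G (pull f s)
    connSub-pull G H f h fh hf iso (V , E) ((symm , sub) , (x , x∈V) , conn) =
      (symm′ , sub′) , (h x , ∈-pull⁺ f V (h x) (subst (_∈ₛ V) (sym (fh x)) x∈V)) , conn′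
      where
      symm′ : ∀ i j → entry (pullE f E) i j ≡ entry (pullE f E) j i
      symm′ i j = trans (entry-pull f E i j) (trans (symm (f i) (f j)) (sym (entry-pull f E j i)))
      sub′ : ∀ i j → entry (pullE f E) i j ≡ true → (G i j ≡ true) × (i ∈ₛ pullV f V) × (j ∈ₛ pullV f V)
      sub′ i j e with sub (f i) (f j) (trans (sym (entry-pull f E i j)) e)
      ... | Hfifj , fi∈V , fj∈V = trans (iso i j) Hfifj , ∈-pull⁺ f V i fi∈V , ∈-pull⁺ f V j fj∈V
      conn′ : ∀ i j → i ∈ₛ pullV f V → j ∈ₛ pullV f V → Reach (pullV f V) (pullE f E) i j
      conn′ i j i∈ j∈ = subst₂ (Reach (pullV f V) (pullE f E)) (hf i) (hf j)
                          (reach-pull f h fh (conn (f i) (f j) (∈-pull⁻ f V i i∈) (∈-pull⁻ f V j j∈)))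

    -- The core index is an isomorphism invariant: pulling back is a bijection
    -- between the connected subgraphs of H and those of G.
    coreIndex-transfer : (G H : Graph n) (f h : Fin n → Fin n) → (∀ i → f (h i) ≡ i) → (∀ i → h (f i) ≡ i) →
                         (∀ i j → G i j ≡ H (f i) (f j)) → ∀ {k} → CoreIndex H k → CoreIndex G k
    coreIndex-transfer G H f h fh hf iso c =
      count-⇔ (λ { s (t , conn , refl) → connSub-pull G H f h fh hf iso t conn })
              (λ s conn → pull h s , connSub-pull H G h f hf fh iso⁻¹ s conn , sym (pull-pull h f hf s))
              (count-image (pull f) pull-injective c)
      where
      iso⁻¹ : ∀ i j → H i j ≡ G (h i) (h j)
      iso⁻¹ i j = trans (cong₂ H (sym (fh i)) (sym (fh j))) (sym (iso (h i) (h j)))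
      pull-injective : ∀ {s t} → pull f s ≡ pull f t → s ≡ t
      pull-injective {s} {t} e = trans (sym (pull-pull f h fh s)) (trans (cong (pull h) e) (pull-pull f h fh t))

    coreIndex-≅ : {G H : Graph n} → G ≅ H → ∀ {k} → CoreIndex H k → CoreIndex G k
    coreIndex-≅ {G} {H} (σ , iso) =
      coreIndex-transfer G H (σ ⟨$⟩ʳ_) (σ ⟨$⟩ˡ_) (λ _ → inverseʳ σ) (λ _ → inverseˡ σ) iso

module Rooted where

  open import Defs
  open Counting
  open import Data.Nat using (ℕ; suc) renaming (zero to zeroℕ)
  open import Data.Bool using (Bool; true; false; _∨_)
  open import Data.Bool.Properties using (¬-not; ∨-zeroʳ)
  open import Data.Sum using (_⊎_; inj₁; inj₂)
  open import Data.Empty using (⊥; ⊥-elim)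
  open import Data.Fin using (Fin; zero; suc)
  open import Data.Fin.Subset using (Subset) renaming (_∈_ to _∈ₛ_)
  open import Data.Vec using (Vec; lookup; replicate)
  open import Data.Vec.Properties using (lookup-replicate; tabulate∘lookup; tabulate-cong; []=⇒lookup; lookup⇒[]=)
  open import Data.Product using (∃; _×_; _,_; proj₁; proj₂)
  open import Relation.Binary.PropositionalEquality using (_≡_; _≢_; refl; sym; trans; cong; cong₂; subst)

  Mark : ℕ → Set
  Mark m = Fin m → Bool

  true≢false : true ≢ false
  true≢false ()

  false≢true : false ≢ true
  false≢true ()

  ∅ : ∀ {m} → Mark m
  ∅ _ = false

  _∪_ : ∀ {m} → Mark m → Mark m → Mark m
  (S ∪ T) x = S x ∨ T x

  ∪-split : ∀ {m} (S T : Mark m) x → (S ∪ T) x ≡ true → (S x ≡ true) ⊎ (T x ≡ true)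
  ∪-split S T x e with S x
  ... | true = inj₁ refl
  ... | false = inj₂ e

  ∪-introˡ : ∀ {m} (S T : Mark m) x → S x ≡ true → (S ∪ T) x ≡ true
  ∪-introˡ S T x e rewrite e = refl

  ∪-introʳ : ∀ {m} (S T : Mark m) x → T x ≡ true → (S ∪ T) x ≡ true
  ∪-introʳ S T x e rewrite e = ∨-zeroʳ (S x)

  infixr 5 _◂_
  _◂_ : ∀ {m} → Bool → Mark m → Mark (suc m)
  (b ◂ M) zero = b
  (b ◂ M) (suc i) = M i

  ∅-◂ : ∀ {m} (x : Fin (suc m)) → ∅ x ≡ (false ◂ ∅) x
  ∅-◂ zero = refl
  ∅-◂ (suc x) = refl

  isZero : ∀ {m} → Mark (suc m)
  isZero = true ◂ ∅

  isLast : ∀ {m} → Mark (suc m)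
  isLast {zeroℕ} = true ◂ ∅
  isLast {suc m} = false ◂ isLast

  isZero-≡ : ∀ {m} {x : Fin (suc m)} → isZero x ≡ true → x ≡ zero
  isZero-≡ {x = zero} _ = refl

  lookup-ext : ∀ {A : Set} {m} (u v : Vec A m) → (∀ j → lookup u j ≡ lookup v j) → u ≡ v
  lookup-ext u v eq = trans (sym (tabulate∘lookup u)) (trans (tabulate-cong eq) (tabulate∘lookup v))

  -- Connected subgraphs through a vertex v are exactly the
  -- {v}-rooted ones; adding vertices one at a time needs general roots.
  Rooted : ∀ {m} → Graph m → Mark m → Mark m → Sub m → Set
  Rooted G S M (V , E) =
    IsSubgraph G (V , E) × (∀ x → S x ≡ true → x ∈ₛ V) × (∀ x → M x ≡ true → x ∈ₛ V) ×
    (∀ y → y ∈ₛ V → ∃ λ x → S x ≡ true × Reach V E y x)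

  reach-trans : ∀ {m} {V : Subset m} {E a b c} → Reach V E a b → Reach V E b c → Reach V E a c
  reach-trans r (here _) = r
  reach-trans r (step r′ e) = step (reach-trans r r′) e

  module _ {m : ℕ} {G : Graph m} where

    rooted-cong : ∀ {S S′ M M′ : Mark m} → (∀ x → S x ≡ S′ x) → (∀ x → M x ≡ M′ x) →
                  ∀ s → Rooted G S M s → Rooted G S′ M′ s
    rooted-cong eS eM (V , E) (sub , S⊆V , M⊆V , toRoot) =
      sub , (λ x e → S⊆V x (trans (eS x) e)) , (λ x e → M⊆V x (trans (eM x) e)) ,
      (λ y y∈V → let (x , Sx , r) = toRoot y y∈V in x , trans (sym (eS x)) Sx , r)

    count-rooted-cong : ∀ {S S′ M M′ : Mark m} {k} → (∀ x → S x ≡ S′ x) → (∀ x → M x ≡ M′ x) →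
                        Count (Rooted G S M) k → Count (Rooted G S′ M′) k
    count-rooted-cong eS eM =
      count-⇔ (rooted-cong eS eM) (rooted-cong (λ x → sym (eS x)) (λ x → sym (eM x)))

    -- Reachability in a subgraph is symmetric, because its edge matrix is.
    reach-sym : ∀ {V E} → IsSubgraph G (V , E) → ∀ {a b} → Reach V E a b → Reach V E b a
    reach-sym sub (here a∈V) = here a∈V
    reach-sym sub@(symm , inG) (step {j} {k} r e) =
      reach-trans (step (here (proj₂ (proj₂ (inG j k e)))) (trans (symm k j) e)) (reach-sym sub r)

  module _ {m : ℕ} {G : Graph (suc m)} where

    connected⇒rooted : ∀ {V E} → ConnSub G (V , E) → zero ∈ₛ V → Rooted G isZero ∅ (V , E)
    connected⇒rooted {V = V} (sub , _ , conn) 0∈V =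
      sub , (λ x e → subst (_∈ₛ V) (sym (isZero-≡ e)) 0∈V) , (λ x ()) , (λ y y∈V → zero , refl , conn y zero y∈V 0∈V)

    rooted⇒connected : ∀ {V E} → Rooted G isZero ∅ (V , E) → ConnSub G (V , E)
    rooted⇒connected {V = V} {E} (sub , S⊆V , _ , toRoot) = sub , (zero , S⊆V zero refl) , conn
      where
      toZero : ∀ y → y ∈ₛ V → Reach V E y zero
      toZero y y∈V = let (x , Sx , r) = toRoot y y∈V in subst (Reach V E y) (isZero-≡ Sx) r
      conn : ∀ i j → i ∈ₛ V → j ∈ₛ V → Reach V E i j
      conn i j i∈V j∈V = reach-trans (toZero i i∈V) (reach-sym sub (toZero j j∈V))

  emptySub : ∀ {m} → Sub m
  emptySub {m} = replicate m false , replicate m (replicate m false)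

  entry-empty : ∀ {m} (i j : Fin m) → entry (proj₂ emptySub) i j ≡ false
  entry-empty i j = trans (cong (λ row → lookup row j) (lookup-replicate i _)) (lookup-replicate j false)

  module _ {m : ℕ} {G : Graph m} where

    rootless : ∀ {V E} → Rooted G ∅ ∅ (V , E) → ∀ {y} → y ∈ₛ V → ⊥
    rootless (_ , _ , _ , toRoot) y∈V with toRoot _ y∈V
    ... | _ , () , _

    rootless-empty : ∀ s → Rooted G ∅ ∅ s → s ≡ emptySub
    rootless-empty (V , E) R@((_ , inG) , _) = cong₂ _,_
      (lookup-ext V _ λ i → trans (noVertex i) (sym (lookup-replicate i false)))
      (lookup-ext E _ λ i → lookup-ext _ _ λ j → trans (noEdge i j) (sym (entry-empty i j)))
      where
      noVertex : ∀ i → lookup V i ≡ false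
      noVertex i = ¬-not λ e → rootless R (lookup⇒[]= i V e)
      noEdge : ∀ i j → entry E i j ≡ false
      noEdge i j = ¬-not λ e → rootless R (proj₁ (proj₂ (inG i j e)))

    empty-rooted : Rooted G ∅ ∅ emptySub
    empty-rooted =
      ((λ i j → trans (entry-empty i j) (sym (entry-empty j i))) ,
       (λ i j e → ⊥-elim (false≢true (trans (sym (entry-empty i j)) e)))) ,
      (λ x ()) , (λ x ()) ,
      (λ y y∈V → ⊥-elim (false≢true (trans (sym (lookup-replicate y false)) ([]=⇒lookup y∈V))))

    count-rootless : Count (Rooted G ∅ ∅) 1
    count-rootless = count-⇔ (λ s s≡∅ → subst (Rooted G ∅ ∅) (sym s≡∅) empty-rooted) rootless-empty
                             (count-singleton emptySub)

module Extension where

  open import Defs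
  open Rooted
  open import Data.Nat using (ℕ; suc)
  open import Data.Bool using (Bool; true; false)
  open import Data.Bool.Properties using (¬-not)
  open import Data.Fin using (Fin; zero; suc)
  open import Data.Fin.Subset using (Subset) renaming (_∈_ to _∈ₛ_)
  open import Data.Fin.Subset.Properties using (drop-there)
  open import Data.Vec using (Vec; []; _∷_; lookup; zipWith; map; head; tail)
  open import Data.Vec.Properties using (lookup-zipWith)
  open import Data.Vec.Base using (here; there)
  open import Data.Product using (Σ; ∃; _×_; _,_; proj₁; proj₂)
  open import Data.Sum using (_⊎_; inj₁; inj₂)
  open import Data.Empty using (⊥-elim)
  open import Relation.Binary.PropositionalEquality using (_≡_; refl; sym; trans; cong; cong₂; subst)

  ∈-head : ∀ {m b} {V : Subset m} → zero ∈ₛ (b ∷ V) → b ≡ true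
  ∈-head here = refl

  -- ext b t (V, E): the subgraph on Fin (suc m) that extends (V, E) by the new
  -- vertex zero (present iff b) joined to the old vertices selected by t.
  extE : ∀ {m} → Vec Bool m → Vec (Vec Bool m) m → Vec (Vec Bool (suc m)) (suc m)
  extE t E = (false ∷ t) ∷ zipWith _∷_ t E

  ext : ∀ {m} → Bool → Vec Bool m → Sub m → Sub (suc m)
  ext b t (V , E) = (b ∷ V) , extE t E

  module _ {m : ℕ} (t : Vec Bool m) (E : Vec (Vec Bool m) m) where

    entry-old-old : ∀ i j → entry (extE t E) (suc i) (suc j) ≡ entry E i j
    entry-old-old i j = cong (λ row → lookup row (suc j)) (lookup-zipWith _∷_ i t E)

    entry-old-new : ∀ i → entry (extE t E) (suc i) zero ≡ lookup t i
    entry-old-new i = cong (λ row → lookup row zero) (lookup-zipWith _∷_ i t E)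

  tails-zipWith : ∀ {m n} (t : Vec Bool n) (E : Vec (Vec Bool m) n) → map tail (zipWith _∷_ t E) ≡ E
  tails-zipWith [] [] = refl
  tails-zipWith (x ∷ t) (r ∷ E) = cong (r ∷_) (tails-zipWith t E)

  ext-injective : ∀ {m b b′} {t t′ : Vec Bool m} {r r′} → ext b t r ≡ ext b′ t′ r′ → (b ≡ b′) × (t ≡ t′) × (r ≡ r′)
  ext-injective {t = t} {t′} {r = V , E} {V′ , E′} e =
    cong (λ s → head (proj₁ s)) e , cong (λ s → tail (head (proj₂ s))) e ,
    cong₂ _,_ (cong (λ s → tail (proj₁ s)) e)
              (trans (sym (tails-zipWith t E)) (trans (cong (λ s → map tail (tail (proj₂ s))) e) (tails-zipWith t′ E′)))

  ext-injectiveʳ : ∀ {m b} {t : Vec Bool m} {r r′} → ext b t r ≡ ext b t r′ → r ≡ r′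
  ext-injectiveʳ e = proj₂ (proj₂ (ext-injective e))

  module OneVertexExtension {m} (G : Graph m) (G′ : Graph (suc m)) (N : Mark m)
    (old-old : ∀ i j → G′ (suc i) (suc j) ≡ G i j) (loopless : G′ zero zero ≡ false)
    (new-old : ∀ j → G′ zero (suc j) ≡ N j) (old-new : ∀ j → G′ (suc j) zero ≡ N j) where

    decompose : ∀ s → IsSubgraph G′ s → Σ Bool λ b → Σ (Vec Bool m) λ t → Σ (Sub m) λ r → s ≡ ext b t r
    decompose ((b ∷ V) , ((x ∷ t) ∷ rows)) (symm , inG) =
      b , t , (V , map tail rows) , cong₂ _,_ refl (cong₂ _∷_ (cong (_∷ t) x≡false) (rows-split t rows (λ i → symm (suc i) zero)))
      where
      x≡false : x ≡ false
      x≡false = ¬-not λ e → true≢false (trans (sym (proj₁ (inG zero zero e))) loopless)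
      rows-split : ∀ {n} (t : Vec Bool n) (rows : Vec (Vec Bool (suc m)) n) →
                   (∀ i → lookup (lookup rows i) zero ≡ lookup t i) → rows ≡ zipWith _∷_ t (map tail rows)
      rows-split [] [] _ = refl
      rows-split (x ∷ t) ((y ∷ r) ∷ rows) h = cong₂ _∷_ (cong (_∷ r) (h zero)) (rows-split t rows (λ i → h (suc i)))

    Admissible : Bool → Vec Bool m → Subset m → Set
    Admissible b t V = ∀ j → lookup t j ≡ true → (N j ≡ true) × (b ≡ true) × (j ∈ₛ V)

    subgraph⇒ : ∀ {b t V E} → IsSubgraph G′ (ext b t (V , E)) → IsSubgraph G (V , E) × Admissible b t V
    subgraph⇒ {b} {t} {V} {E} (symm , inG) =
      ((λ i j → trans (sym (entry-old-old t E i j)) (trans (symm (suc i) (suc j)) (entry-old-old t E j i))) ,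
       (λ i j e → let (Gij , i∈ , j∈) = inG (suc i) (suc j) (trans (entry-old-old t E i j) e)
                  in trans (sym (old-old i j)) Gij , drop-there i∈ , drop-there j∈)) ,
      (λ j e → let (Nj , 0∈ , j∈) = inG zero (suc j) e in trans (sym (new-old j)) Nj , ∈-head 0∈ , drop-there j∈)

    subgraph⇐ : ∀ {b t V E} → IsSubgraph G (V , E) → Admissible b t V → IsSubgraph G′ (ext b t (V , E))
    subgraph⇐ {b} {t} {V} {E} (symm , inG) adm = symm′ , inG′
      where
      symm′ : ∀ i j → entry (extE t E) i j ≡ entry (extE t E) j i
      symm′ zero zero = refl
      symm′ zero (suc j) = sym (entry-old-new t E j)
      symm′ (suc i) zero = entry-old-new t E i
      symm′ (suc i) (suc j) = trans (entry-old-old t E i j) (trans (symm i j) (sym (entry-old-old t E j i)))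
      new∈ : ∀ {j} → lookup t j ≡ true → zero ∈ₛ (b ∷ V)
      new∈ {j} e with adm j e
      ... | _ , refl , _ = here
      inG′ : ∀ i j → entry (extE t E) i j ≡ true → (G′ i j ≡ true) × (i ∈ₛ (b ∷ V)) × (j ∈ₛ (b ∷ V))
      inG′ zero (suc j) e = let (Nj , _ , j∈) = adm j e in trans (new-old j) Nj , new∈ e , there j∈
      inG′ (suc i) zero e = let e′ = trans (sym (entry-old-new t E i)) e
                                (Ni , _ , i∈) = adm i e′ in trans (old-new i) Ni , there i∈ , new∈ e′
      inG′ (suc i) (suc j) e = let (Gij , i∈ , j∈) = inG i j (trans (sym (entry-old-old t E i j)) e)
                               in trans (old-old i j) Gij , there i∈ , there j∈

    absent⇒no-edges : ∀ {t V E} → IsSubgraph G′ (ext false t (V , E)) → ∀ j → lookup t j ≡ false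
    absent⇒no-edges sub j = ¬-not λ e → true≢false (sym (proj₁ (proj₂ (proj₂ (subgraph⇒ sub) j e))))

    lift : ∀ {b t V E} {i j : Fin m} → Reach V E i j → Reach (b ∷ V) (extE t E) (suc i) (suc j)
    lift (here i∈V) = here (there i∈V)
    lift {t = t} {E = E} (step {j} {k} r e) = step (lift r) (trans (entry-old-old t E j k) e)

    reach-from-old : ∀ {b t V E} {i : Fin m} {y : Fin (suc m)} → Reach (b ∷ V) (extE t E) (suc i) y →
                     (∃ λ u → lookup t u ≡ true × Reach V E i u) ⊎ (∃ λ k → y ≡ suc k × Reach V E i k)
    reach-from-old {i = i} (here i∈) = inj₂ (i , refl , here (drop-there i∈))
    reach-from-old (step r e) with reach-from-old r
    ... | inj₁ viaNew = inj₁ viaNew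
    reach-from-old {t = t} {E = E} (step {k = zero} r e) | inj₂ (j , refl , rj) =
      inj₁ (j , trans (sym (entry-old-new t E j)) e , rj)
    reach-from-old {t = t} {E = E} (step {k = suc k} r e) | inj₂ (j , refl , rj) =
      inj₂ (k , refl , step rj (trans (sym (entry-old-old t E j k)) e))

    reach-from-new : ∀ {b t V E} {y : Fin (suc m)} → (∀ u → lookup t u ≡ true → u ∈ₛ V) → Reach (b ∷ V) (extE t E) zero y →
                     (y ≡ zero) ⊎ (∃ λ u → ∃ λ k → lookup t u ≡ true × y ≡ suc k × Reach V E u k)
    reach-from-new t⊆V (here _) = inj₁ refl
    reach-from-new t⊆V (step r e) with reach-from-new t⊆V r
    reach-from-new t⊆V (step {k = zero} r ()) | inj₁ refl
    reach-from-new t⊆V (step {k = suc k} r e) | inj₁ refl = inj₂ (k , k , e , refl , here (t⊆V k e))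
    reach-from-new t⊆V (step {k = zero} r e) | inj₂ _ = inj₁ refl
    reach-from-new {t = t} {E = E} t⊆V (step {k = suc k} r e) | inj₂ (u , j , tu , refl , rj) =
      inj₂ (u , k , tu , refl , step rj (trans (sym (entry-old-old t E j k)) e))

    newRoot⇒ : ∀ {S M c b t V E} → Rooted G′ (true ◂ S) (c ◂ M) (ext b t (V , E)) →
               (b ≡ true) × (∀ j → lookup t j ≡ true → N j ≡ true) × Rooted G (S ∪ lookup t) M (V , E)
    newRoot⇒ {S} {M} {c} {b} {t} {V} {E} (sub , S⊆V , M⊆V , toRoot) =
      ∈-head (S⊆V zero refl) , (λ j e → proj₁ (adm j e)) ,
      proj₁ (subgraph⇒ sub) , S∪t⊆V , (λ x e → drop-there (M⊆V (suc x) e)) , toRoot′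
      where
      adm = proj₂ (subgraph⇒ sub)
      S∪t⊆V : ∀ x → (S ∪ lookup t) x ≡ true → x ∈ₛ V
      S∪t⊆V x e with ∪-split S (lookup t) x e
      ... | inj₁ Sx = drop-there (S⊆V (suc x) Sx)
      ... | inj₂ tx = proj₂ (proj₂ (adm x tx))
      toRoot′ : ∀ y → y ∈ₛ V → ∃ λ x → (S ∪ lookup t) x ≡ true × Reach V E y x
      toRoot′ y y∈V with toRoot (suc y) (there y∈V)
      ... | x′ , Sx′ , r with reach-from-old r
      ...   | inj₁ (u , tu , ru) = u , ∪-introʳ S (lookup t) u tu , ru
      toRoot′ y y∈V | .(suc k) , Sk , r | inj₂ (k , refl , rk) = k , ∪-introˡ S (lookup t) k Sk , rk

    newRoot⇐ : ∀ {S M c t V E} → (∀ j → lookup t j ≡ true → N j ≡ true) → Rooted G (S ∪ lookup t) M (V , E) →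
               Rooted G′ (true ◂ S) (c ◂ M) (ext true t (V , E))
    newRoot⇐ {S} {M} {c} {t} {V} {E} t⊆N (sub , S∪t⊆V , M⊆V , toRoot) =
      subgraph⇐ sub (λ j e → t⊆N j e , refl , S∪t⊆V j (∪-introʳ S (lookup t) j e)) , S⊆V′ , M⊆V′ , toRoot′
      where
      S⊆V′ : ∀ x → (true ◂ S) x ≡ true → x ∈ₛ (true ∷ V)
      S⊆V′ zero _ = here
      S⊆V′ (suc x) e = there (S∪t⊆V x (∪-introˡ S (lookup t) x e))
      M⊆V′ : ∀ x → (c ◂ M) x ≡ true → x ∈ₛ (true ∷ V)
      M⊆V′ zero _ = here
      M⊆V′ (suc x) e = there (M⊆V x e)
      toRoot′ : ∀ y → y ∈ₛ (true ∷ V) → ∃ λ x → (true ◂ S) x ≡ true × Reach (true ∷ V) (extE t E) y x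
      toRoot′ zero _ = zero , refl , here here
      toRoot′ (suc y) y∈ with toRoot y (drop-there y∈)
      ... | x , Sx , r with ∪-split S (lookup t) x Sx
      ...   | inj₁ S-x = suc x , S-x , lift r
      ...   | inj₂ t-x = zero , refl , step (lift r) (trans (entry-old-new t E x) t-x)

    absent⇒ : ∀ {S M t V E} → Rooted G′ (false ◂ S) (false ◂ M) (ext false t (V , E)) →
              (∀ j → lookup t j ≡ false) × Rooted G S M (V , E)
    absent⇒ {S} {M} {t} {V} {E} (sub , S⊆V , M⊆V , toRoot) =
      no-edges , proj₁ (subgraph⇒ sub) , (λ x e → drop-there (S⊆V (suc x) e)) ,
      (λ x e → drop-there (M⊆V (suc x) e)) , toRoot′
      where
      no-edges = absent⇒no-edges sub
      toRoot′ : ∀ y → y ∈ₛ V → ∃ λ x → S x ≡ true × Reach V E y x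
      toRoot′ y y∈V with toRoot (suc y) (there y∈V)
      ... | x′ , Sx′ , r with reach-from-old r
      ...   | inj₁ (u , tu , _) = ⊥-elim (true≢false (trans (sym tu) (no-edges u)))
      toRoot′ y y∈V | .(suc k) , Sk , r | inj₂ (k , refl , rk) = k , Sk , rk

    absent⇐ : ∀ {S M t V E} → (∀ j → lookup t j ≡ false) → Rooted G S M (V , E) →
              Rooted G′ (false ◂ S) (false ◂ M) (ext false t (V , E))
    absent⇐ {S} {M} {t} {V} {E} no-edges (sub , S⊆V , M⊆V , toRoot) =
      subgraph⇐ sub (λ j e → ⊥-elim (true≢false (trans (sym e) (no-edges j)))) , S⊆V′ , M⊆V′ , toRoot′
      where
      S⊆V′ : ∀ x → (false ◂ S) x ≡ true → x ∈ₛ (false ∷ V)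
      S⊆V′ (suc x) e = there (S⊆V x e)
      M⊆V′ : ∀ x → (false ◂ M) x ≡ true → x ∈ₛ (false ∷ V)
      M⊆V′ (suc x) e = there (M⊆V x e)
      toRoot′ : ∀ y → y ∈ₛ (false ∷ V) → ∃ λ x → (false ◂ S) x ≡ true × Reach (false ∷ V) (extE t E) y x
      toRoot′ (suc y) y∈ = let (x , Sx , r) = toRoot y (drop-there y∈) in suc x , Sx , lift r

    avoiding⇒ : ∀ {t V E} → ConnSub G′ (ext false t (V , E)) → (∀ j → lookup t j ≡ false) × ConnSub G (V , E)
    avoiding⇒ {t} {V} {E} (sub , (x , x∈) , conn) = no-edges , proj₁ (subgraph⇒ sub) , nonempty x x∈ , conn′
      where
      no-edges = absent⇒no-edges sub
      nonempty : ∀ x → x ∈ₛ (false ∷ V) → ∃ λ i → i ∈ₛ V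
      nonempty (suc x) x∈ = x , drop-there x∈
      conn′ : ∀ i j → i ∈ₛ V → j ∈ₛ V → Reach V E i j
      conn′ i j i∈ j∈ with reach-from-old (conn (suc i) (suc j) (there i∈) (there j∈))
      ... | inj₁ (u , tu , _) = ⊥-elim (true≢false (trans (sym tu) (no-edges u)))
      ... | inj₂ (k , refl , r) = r

    avoiding⇐ : ∀ {t V E} → (∀ j → lookup t j ≡ false) → ConnSub G (V , E) → ConnSub G′ (ext false t (V , E))
    avoiding⇐ {t} {V} {E} no-edges (sub , (x , x∈) , conn) =
      subgraph⇐ sub (λ j e → ⊥-elim (true≢false (trans (sym e) (no-edges j)))) , (suc x , there x∈) , conn′
      where
      conn′ : ∀ i j → i ∈ₛ (false ∷ V) → j ∈ₛ (false ∷ V) → Reach (false ∷ V) (extE t E) i j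
      conn′ (suc i) (suc j) i∈ j∈ = lift (conn i j (drop-there i∈) (drop-there j∈))

  module PendantExtension {m} (G : Graph (suc m)) (G′ : Graph (suc (suc m))) (N : Mark (suc m))
    (old-old : ∀ i j → G′ (suc i) (suc j) ≡ G i j) (loopless : G′ zero zero ≡ false)
    (new-old : ∀ j → G′ zero (suc j) ≡ N j) (old-new : ∀ j → G′ (suc j) zero ≡ N j)
    (N⊆zero : ∀ j → N j ≡ true → j ≡ zero) (N-zero : N zero ≡ true) where

    open OneVertexExtension G G′ N old-old loopless new-old old-new

    pendant⇒ : ∀ {S M c t V E} → Rooted G′ (false ◂ S) (c ◂ M) (ext true t (V , E)) →
               (∀ j → lookup t j ≡ true → j ≡ zero) × (lookup t zero ≡ true) × Rooted G S (M ∪ isZero) (V , E)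
    pendant⇒ {S} {M} {c} {t} {V} {E} (sub , S⊆V , M⊆V , toRoot) =
      t⊆zero , proj₁ zero-to-root , proj₁ (subgraph⇒ sub) , (λ x e → drop-there (S⊆V (suc x) e)) , M′⊆V , toRoot′
      where
      adm = proj₂ (subgraph⇒ sub)
      t⊆zero : ∀ j → lookup t j ≡ true → j ≡ zero
      t⊆zero j e = N⊆zero j (proj₁ (adm j e))
      t⊆V : ∀ u → lookup t u ≡ true → u ∈ₛ V
      t⊆V u e = proj₂ (proj₂ (adm u e))
      -- The new vertex reaches a root only through its edge to zero.
      zero-to-root : (lookup t zero ≡ true) × (∃ λ k → S k ≡ true × Reach V E zero k)
      zero-to-root with toRoot zero here
      ... | x′ , Sx′ , r with reach-from-new t⊆V r
      ...   | inj₁ refl = ⊥-elim (true≢false (sym Sx′))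
      zero-to-root | .(suc k) , Sk , r | inj₂ (u , k , tu , refl , rk) with t⊆zero u tu
      ... | refl = tu , k , Sk , rk
      M′⊆V : ∀ x → (M ∪ isZero) x ≡ true → x ∈ₛ V
      M′⊆V x e with ∪-split M isZero x e
      ... | inj₁ Mx = drop-there (M⊆V (suc x) Mx)
      ... | inj₂ x≡0 = subst (_∈ₛ V) (sym (isZero-≡ x≡0)) (t⊆V zero (proj₁ zero-to-root))
      toRoot′ : ∀ y → y ∈ₛ V → ∃ λ x → S x ≡ true × Reach V E y x
      toRoot′ y y∈V with toRoot (suc y) (there y∈V)
      ... | x′ , Sx′ , r with reach-from-old r
      ...   | inj₁ (u , tu , ru) with t⊆zero u tu
      ...     | refl = let (k , Sk , rk) = proj₂ zero-to-root in k , Sk , reach-trans ru rk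
      toRoot′ y y∈V | .(suc k) , Sk , r | inj₂ (k , refl , rk) = k , Sk , rk

    pendant⇐ : ∀ {S M c t V E} → (∀ j → lookup t j ≡ true → j ≡ zero) → lookup t zero ≡ true →
               Rooted G S (M ∪ isZero) (V , E) → Rooted G′ (false ◂ S) (c ◂ M) (ext true t (V , E))
    pendant⇐ {S} {M} {c} {t} {V} {E} t⊆zero t-zero (sub , S⊆V , M′⊆V , toRoot) =
      subgraph⇐ sub adm , S⊆V′ , M⊆V′ , toRoot′
      where
      zero∈V : zero ∈ₛ V
      zero∈V = M′⊆V zero (∪-introʳ M isZero zero refl)
      adm : Admissible true t V
      adm j e with t⊆zero j e
      ... | refl = N-zero , refl , zero∈V
      S⊆V′ : ∀ x → (false ◂ S) x ≡ true → x ∈ₛ (true ∷ V)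
      S⊆V′ (suc x) e = there (S⊆V x e)
      M⊆V′ : ∀ x → (c ◂ M) x ≡ true → x ∈ₛ (true ∷ V)
      M⊆V′ zero _ = here
      M⊆V′ (suc x) e = there (M′⊆V x (∪-introˡ M isZero x e))
      toRoot′ : ∀ y → y ∈ₛ (true ∷ V) → ∃ λ x → (false ◂ S) x ≡ true × Reach (true ∷ V) (extE t E) y x
      toRoot′ zero _ = let (k , Sk , rk) = toRoot zero zero∈V in suc k , Sk , reach-trans (step (here here) t-zero) (lift rk)
      toRoot′ (suc y) y∈ = let (k , Sk , rk) = toRoot y (drop-there y∈) in suc k , Sk , lift rk

module Recurrences where

  open import Defs
  open Counting
  open Rooted
  open Extension
  open import Data.Nat using (ℕ; zero; suc; _+_)
  open import Data.Nat.Properties using (+-identityʳ)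
  open import Data.Bool using (Bool; true; false; _∨_; _∧_)
  open import Data.Bool.Properties using (¬-not; ∨-identityʳ; ∧-identityʳ; ∧-zeroʳ)
  open import Data.Fin using (Fin; zero; suc)
  open import Data.Fin.Subset using (Subset)
  open import Data.Vec using (Vec; []; _∷_; lookup; replicate; head; tail)
  open import Data.Vec.Properties using (lookup-replicate)
  open import Data.Vec.Base using (here)
  open import Data.List.Relation.Unary.Any using () renaming (here to here′; there to there′)
  open import Data.Unit using (tt)
  open import Data.List using (List; []; _∷_; map)
  open import Data.List.Membership.Propositional using (_∈_)
  open import Data.List.Relation.Unary.Unique.Propositional using (Unique)
  open import Data.List.Relation.Unary.AllPairs using ([]; _∷_)
  open import Data.List.Relation.Unary.All using ([]; _∷_)
  open import Data.Nat.ListAction using (sum)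
  open import Data.Product using (Σ; ∃; _×_; _,_; proj₁; proj₂)
  open import Data.Sum using (_⊎_; inj₁; inj₂)
  open import Data.Empty using (⊥; ⊥-elim)
  open import Relation.Binary.PropositionalEquality using (_≡_; refl; sym; trans; cong; cong₂; subst)

  zeros : ∀ {m} → Vec Bool m
  zeros = replicate _ false

  no-edges⇒zeros : ∀ {m} (t : Vec Bool m) → (∀ j → lookup t j ≡ false) → t ≡ zeros
  no-edges⇒zeros t h = lookup-ext t zeros (λ j → trans (h j) (sym (lookup-replicate j false)))

  module ExtensionCounts {m} (G : Graph m) (G′ : Graph (suc m)) (N : Mark m)
    (old-old : ∀ i j → G′ (suc i) (suc j) ≡ G i j) (loopless : G′ zero zero ≡ false)
    (new-old : ∀ j → G′ zero (suc j) ≡ N j) (old-new : ∀ j → G′ (suc j) zero ≡ N j) where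

    open OneVertexExtension G G′ N old-old loopless new-old old-new

    decompose-with : ∀ (P : Sub (suc m) → Set) s → IsSubgraph G′ s → P s →
                     Σ Bool λ b → Σ (Vec Bool m) λ t → Σ (Subset m) λ V → Σ (Vec (Vec Bool m) m) λ E →
                     P (ext b t (V , E)) × s ≡ ext b t (V , E)
    decompose-with P s sub p with decompose s sub
    ... | b , t , (V , E) , s≡ = b , t , V , E , subst P s≡ p , s≡

    Old : (Sub m → Set) → Sub (suc m) → Set
    Old P s = ∃ λ r → P r × s ≡ ext false zeros r

    count-connected : ∀ {f p} → Count (ConnSub G) f → Count (Rooted G′ isZero ∅) p → Count (ConnSub G′) (f + p)
    count-connected cf cp = count-⇔ join split (count-⊎ (count-image (ext false zeros) ext-injectiveʳ cf) cp apart)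
      where
      apart : ∀ s → Old (ConnSub G) s → Rooted G′ isZero ∅ s → ⊥
      apart s (r , _ , refl) (_ , S⊆V , _) with S⊆V zero refl
      ... | ()
      join : ∀ s → Old (ConnSub G) s ⊎ Rooted G′ isZero ∅ s → ConnSub G′ s
      join s (inj₁ (r , conn , refl)) = avoiding⇐ (λ j → lookup-replicate j false) conn
      join (V , E) (inj₂ R) = rooted⇒connected R
      split : ∀ s → ConnSub G′ s → Old (ConnSub G) s ⊎ Rooted G′ isZero ∅ s
      split s conn with decompose-with (ConnSub G′) s (proj₁ conn) conn
      ... | true , t , V , E , conn′ , s≡ = inj₂ (subst (Rooted G′ isZero ∅) (sym s≡) (connected⇒rooted conn′ here))
      ... | false , t , V , E , conn′ , s≡ with avoiding⇒ conn′
      ...   | no-edges , conn″ = inj₁ ((V , E) , conn″ , trans s≡ (cong (λ t → ext false t (V , E)) (no-edges⇒zeros t no-edges)))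

    -- If the new vertex is a root, the subgraph is determined
    -- by its edges t ⊆ N to old vertices and a subgraph of G rooted at S ∪ t.
    -- Enumerating the possible t injectively by a list of codes, the count is
    -- the sum over the codes.
    count-newRoot : ∀ {I : Set} {S M c} (codes : List I) (nbrs : I → Vec Bool m) →
      Unique codes → (∀ {i j} → nbrs i ≡ nbrs j → i ≡ j) →
      (∀ i j → lookup (nbrs i) j ≡ true → N j ≡ true) →
      (∀ t → (∀ j → lookup t j ≡ true → N j ≡ true) → ∃ λ i → i ∈ codes × t ≡ nbrs i) →
      (k : I → ℕ) → (∀ i → Count (Rooted G (S ∪ lookup (nbrs i)) M) (k i)) →
      Count (Rooted G′ (true ◂ S) (c ◂ M)) (sum (map k codes))
    count-newRoot {I} {S} {M} {c} codes nbrs unique nbrs-inj nbrs⊆N enumerate k counts =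
      count-⇔ join split (count-⋃ codes k unique apart (λ i → count-image (ext true (nbrs i)) ext-injectiveʳ (counts i)))
      where
      Piece : I → Sub (suc m) → Set
      Piece i s = ∃ λ r → Rooted G (S ∪ lookup (nbrs i)) M r × s ≡ ext true (nbrs i) r
      apart : ∀ {i j s} → Piece i s → Piece j s → i ≡ j
      apart (r , _ , refl) (r′ , _ , e) = nbrs-inj (proj₁ (proj₂ (ext-injective e)))
      join : ∀ s → (∃ λ i → i ∈ codes × Piece i s) → Rooted G′ (true ◂ S) (c ◂ M) s
      join s (i , _ , (V , E) , R , refl) = newRoot⇐ (nbrs⊆N i) R
      split : ∀ s → Rooted G′ (true ◂ S) (c ◂ M) s → ∃ λ i → i ∈ codes × Piece i s
      split s R with decompose-with (Rooted G′ (true ◂ S) (c ◂ M)) s (proj₁ R) R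
      ... | b , t , V , E , R′ , s≡ with newRoot⇒ R′ | enumerate t (proj₁ (proj₂ (newRoot⇒ R′)))
      ...   | refl , _ , R″ | i , i∈ , refl = i , i∈ , (V , E) , R″ , s≡

  module SingleVertex (G : Graph 0) (G′ : Graph 1) (loopless : G′ zero zero ≡ false) where

    open ExtensionCounts G G′ (λ ()) (λ ()) loopless (λ ()) (λ ())

    count-single-root : ∀ {S M : Mark 0} {c} → Count (Rooted G′ (true ◂ S) (c ◂ M)) 1
    count-single-root = count-newRoot (tt ∷ []) (λ _ → []) ([] ∷ []) (λ _ → refl) (λ _ ()) (λ { [] _ → tt , here′ refl , refl })
                          (λ _ → 1) (λ _ → count-rooted-cong (λ ()) (λ ()) count-rootless)

    -- The graph on no vertices has no connected subgraph (they are nonempty).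
    count-connected-none : Count (ConnSub G) 0
    count-connected-none = count-⇔ (λ _ ()) (λ { _ (_ , (() , _) , _) }) count-empty

  lookup-∷zeros : ∀ {m} a (x : Fin (suc m)) → lookup (a ∷ zeros) x ≡ (a ◂ ∅) x
  lookup-∷zeros a zero = refl
  lookup-∷zeros a (suc x) = lookup-replicate x false

  edges⊆zero : ∀ {m} (t : Vec Bool (suc m)) → (∀ j → lookup t j ≡ true → j ≡ zero) → t ≡ lookup t zero ∷ zeros
  edges⊆zero (x ∷ t) h = cong (x ∷_) (no-edges⇒zeros t (λ j → ¬-not λ e → suc≢zero (h (suc j) e)))
    where
    suc≢zero : ∀ {j : Fin _} → Fin.suc j ≡ zero → ⊥
    suc≢zero ()

  module PendantCounts {m} (G : Graph (suc m)) (G′ : Graph (suc (suc m))) (N : Mark (suc m))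
    (old-old : ∀ i j → G′ (suc i) (suc j) ≡ G i j) (loopless : G′ zero zero ≡ false)
    (new-old : ∀ j → G′ zero (suc j) ≡ N j) (old-new : ∀ j → G′ (suc j) zero ≡ N j)
    (N⊆zero : ∀ j → N j ≡ true → j ≡ zero) (N-zero : N zero ≡ true) where

    open OneVertexExtension G G′ N old-old loopless new-old old-new
    open ExtensionCounts G G′ N old-old loopless new-old old-new
    open PendantExtension G G′ N old-old loopless new-old old-new N⊆zero N-zero

    Attached : (Sub (suc m) → Set) → Sub (suc (suc m)) → Set
    Attached P s = ∃ λ r → P r × s ≡ ext true (true ∷ zeros) r

    edges=zero : ∀ (t : Vec Bool (suc m)) → (∀ j → lookup t j ≡ true → j ≡ zero) → lookup t zero ≡ true → t ≡ true ∷ zeros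
    edges=zero t t⊆zero t-zero = trans (edges⊆zero t t⊆zero) (cong (_∷ zeros) t-zero)

    zero-edge⊆zero : ∀ (j : Fin (suc m)) → lookup (true ∷ zeros) j ≡ true → j ≡ zero
    zero-edge⊆zero zero _ = refl
    zero-edge⊆zero (suc j) e = ⊥-elim (false≢true (trans (sym (lookup-replicate j false)) e))

    -- A pendant root: its edge to zero is either absent or present.
    count-pendant-root : ∀ {S M c a b} → Count (Rooted G S M) a → Count (Rooted G (S ∪ isZero) M) b →
                         Count (Rooted G′ (true ◂ S) (c ◂ M)) (a + b)
    count-pendant-root {S} {M} {c} {a} {b} ca cb =
      subst (Count (Rooted G′ (true ◂ S) (c ◂ M))) (cong (a +_) (+-identityʳ b))
        (count-newRoot (false ∷ true ∷ []) (_∷ zeros) (((λ ()) ∷ []) ∷ [] ∷ []) (cong head) nbrs⊆N enumerate k counts)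
      where
      k : Bool → ℕ
      k false = a
      k true = b
      nbrs⊆N : ∀ a j → lookup (a ∷ zeros) j ≡ true → N j ≡ true
      nbrs⊆N a zero _ = N-zero
      nbrs⊆N a (suc j) e = ⊥-elim (false≢true (trans (sym (lookup-replicate j false)) e))
      enumerate : ∀ t → (∀ j → lookup t j ≡ true → N j ≡ true) → ∃ λ a → a ∈ (false ∷ true ∷ []) × t ≡ a ∷ zeros
      enumerate t t⊆N with lookup t zero | edges⊆zero t (λ j e → N⊆zero j (t⊆N j e))
      ... | false | t≡ = false , here′ refl , t≡
      ... | true | t≡ = true , there′ (here′ refl) , t≡
      counts : ∀ a → Count (Rooted G (S ∪ lookup (a ∷ zeros)) M) (k a)
      counts false = count-rooted-cong (λ x → sym (trans (cong (S x ∨_) (trans (lookup-∷zeros false x) (sym (∅-◂ x))))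
                                                         (∨-identityʳ (S x)))) (λ _ → refl) ca
      counts true = count-rooted-cong (λ x → cong (S x ∨_) (sym (lookup-∷zeros true x))) (λ _ → refl) cb

    -- A pendant vertex that is neither root nor marked is absent, or present and
    -- attached to zero (which then becomes marked).
    count-pendant-free : ∀ {S M a b} → Count (Rooted G S M) a → Count (Rooted G S (M ∪ isZero)) b →
                         Count (Rooted G′ (false ◂ S) (false ◂ M)) (a + b)
    count-pendant-free {S} {M} ca cb =
      count-⇔ join split (count-⊎ (count-image (ext false zeros) ext-injectiveʳ ca) (count-image (ext true (true ∷ zeros)) ext-injectiveʳ cb) apart)
      where
      apart : ∀ s → Old (Rooted G S M) s → Attached (Rooted G S (M ∪ isZero)) s → ⊥
      apart s (r , _ , refl) (r′ , _ , e) with proj₁ (ext-injective e)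
      ... | ()
      join : ∀ s → Old (Rooted G S M) s ⊎ Attached (Rooted G S (M ∪ isZero)) s → Rooted G′ (false ◂ S) (false ◂ M) s
      join s (inj₁ (r , R , refl)) = absent⇐ (λ j → lookup-replicate j false) R
      join s (inj₂ (r , R , refl)) = pendant⇐ zero-edge⊆zero refl R
      split : ∀ s → Rooted G′ (false ◂ S) (false ◂ M) s → Old (Rooted G S M) s ⊎ Attached (Rooted G S (M ∪ isZero)) s
      split s R with decompose-with (Rooted G′ (false ◂ S) (false ◂ M)) s (proj₁ R) R
      ... | false , t , V , E , R′ , s≡ = let (no-edges , R″) = absent⇒ R′ in
        inj₁ ((V , E) , R″ , trans s≡ (cong (λ t → ext false t (V , E)) (no-edges⇒zeros t no-edges)))
      ... | true , t , V , E , R′ , s≡ = let (t⊆zero , t-zero , R″) = pendant⇒ R′ in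
        inj₂ ((V , E) , R″ , trans s≡ (cong (λ t → ext true t (V , E)) (edges=zero t t⊆zero t-zero)))

    -- A marked pendant vertex that is not a root is present and attached to zero.
    count-pendant-marked : ∀ {S M b} → Count (Rooted G S (M ∪ isZero)) b → Count (Rooted G′ (false ◂ S) (true ◂ M)) b
    count-pendant-marked {S} {M} cb = count-⇔ join split (count-image (ext true (true ∷ zeros)) ext-injectiveʳ cb)
      where
      join : ∀ s → Attached (Rooted G S (M ∪ isZero)) s → Rooted G′ (false ◂ S) (true ◂ M) s
      join s (r , R , refl) = pendant⇐ zero-edge⊆zero refl R
      split : ∀ s → Rooted G′ (false ◂ S) (true ◂ M) s → Attached (Rooted G S (M ∪ isZero)) s
      split s R with decompose-with (Rooted G′ (false ◂ S) (true ◂ M)) s (proj₁ R) R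
      ... | false , t , V , E , (_ , _ , M⊆V , _) , s≡ = ⊥-elim (false≢true (∈-head (M⊆V zero refl)))
      ... | true , t , V , E , R′ , s≡ = let (t⊆zero , t-zero , R″) = pendant⇒ R′ in
        (V , E) , R″ , trans s≡ (cong (λ t → ext true t (V , E)) (edges=zero t t⊆zero t-zero))

  lastEdge : ∀ {k} → Bool → Vec Bool (suc k)
  lastEdge {zero} c = c ∷ []
  lastEdge {suc k} c = false ∷ lastEdge c

  lastEntry : ∀ {k} → Vec Bool (suc k) → Bool
  lastEntry {zero} (x ∷ []) = x
  lastEntry {suc k} (x ∷ xs) = lastEntry xs

  lookup-lastEdge : ∀ {k} c (x : Fin (suc k)) → lookup (lastEdge c) x ≡ c ∧ isLast x
  lookup-lastEdge {zero} c zero = sym (∧-identityʳ c)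
  lookup-lastEdge {suc k} c zero = sym (∧-zeroʳ c)
  lookup-lastEdge {suc k} c (suc x) = lookup-lastEdge c x

  lastEntry-lastEdge : ∀ {k} c → lastEntry {k} (lastEdge c) ≡ c
  lastEntry-lastEdge {zero} c = refl
  lastEntry-lastEdge {suc k} c = lastEntry-lastEdge {k} c

  edges⊆last : ∀ {k} (t : Vec Bool (suc k)) → (∀ j → lookup t j ≡ true → isLast j ≡ true) → t ≡ lastEdge (lastEntry t)
  edges⊆last {zero} (x ∷ []) _ = refl
  edges⊆last {suc k} (x ∷ xs) h = cong₂ _∷_ (¬-not λ e → false≢true (h zero e)) (edges⊆last xs (λ j → h (suc j)))

  -- G′ is G extended by a vertex adjacent to both the first and the last
  -- vertex of G (closing a path into a cycle).
  module ChordCounts {k} (G : Graph (suc (suc k))) (G′ : Graph (suc (suc (suc k)))) (N : Mark (suc (suc k)))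
    (old-old : ∀ i j → G′ (suc i) (suc j) ≡ G i j) (loopless : G′ zero zero ≡ false)
    (new-old : ∀ j → G′ zero (suc j) ≡ N j) (old-new : ∀ j → G′ (suc j) zero ≡ N j)
    (N⊆ends : ∀ j → N j ≡ true → (j ≡ zero) ⊎ (isLast j ≡ true)) (N-zero : N zero ≡ true)
    (N-last : ∀ j → isLast j ≡ true → N j ≡ true) where

    open ExtensionCounts G G′ N old-old loopless new-old old-new

    ends : Bool × Bool → Vec Bool (suc (suc k))
    ends (a , c) = a ∷ lastEdge c

    ends-injective : ∀ {p q} → ends p ≡ ends q → p ≡ q
    ends-injective {a , c} {a′ , c′} e =
      cong₂ _,_ (cong head e) (trans (sym (lastEntry-lastEdge {k} c)) (trans (cong (λ t → lastEntry (tail t)) e) (lastEntry-lastEdge {k} c′)))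

    ends⊆N : ∀ p j → lookup (ends p) j ≡ true → N j ≡ true
    ends⊆N (true , c) zero _ = N-zero
    ends⊆N (a , c) (suc j) e = N-last (suc j) (conjunct₂ c (isLast j) (trans (sym (lookup-lastEdge c j)) e))
      where
      conjunct₂ : ∀ a b → a ∧ b ≡ true → b ≡ true
      conjunct₂ true b e = e

    choices : List (Bool × Bool)
    choices = (false , false) ∷ (true , false) ∷ (false , true) ∷ (true , true) ∷ []

    choices-unique : Unique choices
    choices-unique = ((λ ()) ∷ (λ ()) ∷ (λ ()) ∷ []) ∷ ((λ ()) ∷ (λ ()) ∷ []) ∷ ((λ ()) ∷ []) ∷ [] ∷ []

    enumerate : ∀ t → (∀ j → lookup t j ≡ true → N j ≡ true) → ∃ λ p → p ∈ choices × t ≡ ends p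
    enumerate (a ∷ t′) t⊆N with lastEntry t′ | edges⊆last t′ (λ j e → only-last j (N⊆ends (suc j) (t⊆N (suc j) e)))
      where
      only-last : ∀ j → (Fin.suc j ≡ zero) ⊎ (isLast (suc j) ≡ true) → isLast j ≡ true
      only-last j (inj₂ e) = e
    enumerate (false ∷ _) _ | false | refl = _ , here′ refl , refl
    enumerate (true ∷ _) _  | false | refl = _ , there′ (here′ refl) , refl
    enumerate (false ∷ _) _ | true | refl = _ , there′ (there′ (here′ refl)) , refl
    enumerate (true ∷ _) _  | true | refl = _ , there′ (there′ (there′ (here′ refl))) , refl

    -- A root closing a cycle: each of its two possible edges is absent or present.
    count-chord-root : ∀ {S M c n₀₀ n₁₀ n₀₁ n₁₁} →
      Count (Rooted G S M) n₀₀ → Count (Rooted G (S ∪ isZero) M) n₁₀ →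
      Count (Rooted G (S ∪ isLast) M) n₀₁ → Count (Rooted G ((S ∪ isLast) ∪ isZero) M) n₁₁ →
      Count (Rooted G′ (true ◂ S) (c ◂ M)) (n₀₀ + (n₁₀ + (n₀₁ + n₁₁)))
    count-chord-root {S} {M} {c} {n₀₀} {n₁₀} {n₀₁} {n₁₁} c₀₀ c₁₀ c₀₁ c₁₁ =
      subst (Count (Rooted G′ (true ◂ S) (c ◂ M))) (cong (λ z → n₀₀ + (n₁₀ + (n₀₁ + z))) (+-identityʳ n₁₁))
        (count-newRoot choices ends choices-unique ends-injective ends⊆N enumerate n counts)
      where
      n : Bool × Bool → ℕ
      n (false , false) = n₀₀
      n (true , false) = n₁₀
      n (false , true) = n₀₁
      n (true , true) = n₁₁
      marks₀₀ : ∀ x → S x ≡ (S ∪ lookup (ends (false , false))) x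
      marks₀₀ zero = sym (∨-identityʳ (S zero))
      marks₀₀ (suc x) rewrite lookup-lastEdge false x = sym (∨-identityʳ (S (suc x)))
      marks₁₀ : ∀ x → (S ∪ isZero) x ≡ (S ∪ lookup (ends (true , false))) x
      marks₁₀ zero = refl
      marks₁₀ (suc x) rewrite lookup-lastEdge false x = refl
      marks₀₁ : ∀ x → (S ∪ isLast) x ≡ (S ∪ lookup (ends (false , true))) x
      marks₀₁ zero = refl
      marks₀₁ (suc x) rewrite lookup-lastEdge true x = refl
      marks₁₁ : ∀ x → ((S ∪ isLast) ∪ isZero) x ≡ (S ∪ lookup (ends (true , true))) x
      marks₁₁ zero = cong (_∨ true) (∨-identityʳ (S zero))
      marks₁₁ (suc x) rewrite lookup-lastEdge true x = ∨-identityʳ (S (suc x) ∨ isLast x)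
      counts : ∀ p → Count (Rooted G (S ∪ lookup (ends p)) M) (n p)
      counts (false , false) = count-rooted-cong marks₀₀ (λ _ → refl) c₀₀
      counts (true , false) = count-rooted-cong marks₁₀ (λ _ → refl) c₁₀
      counts (false , true) = count-rooted-cong marks₀₁ (λ _ → refl) c₀₁
      counts (true , true) = count-rooted-cong marks₁₁ (λ _ → refl) c₁₁

-- The core index of the lollipop, computed by adding its vertices one at a time.
module Lollipop where

  open import Defs
  open Counting
  open Rooted
  open Recurrences
  open import Data.Nat using (ℕ; zero; suc; _+_; _∸_; _≤_; _<_; s≤s; _≡ᵇ_)
  open import Data.Nat.Properties using (m∸n≤m; +-comm; +-suc; +-identityʳ; ≤-trans; n≤1+n; ≤-refl; m≤n+m)
  open import Data.Bool using (Bool; true; false; _∨_; _∧_)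
  open import Data.Bool.Properties using (∨-identityʳ; ∧-zeroʳ; ∧-identityʳ)
  open import Data.Fin using (Fin; zero; suc; toℕ)
  open import Data.Product using (_×_; _,_; proj₁; proj₂)
  open import Data.Sum using (_⊎_; inj₁; inj₂)
  open import Relation.Binary.PropositionalEquality using (_≡_; refl; sym; trans; cong; subst)

  -- The lollipop with its vertices numbered backwards: vertex i of
  -- revLollipop n g is vertex n-1-i of lollipop n g, so vertex zero is the
  -- newest one.  Deleting vertex zero of revLollipop (suc m) g leaves
  -- revLollipop m g (definitionally), so the lollipop arises by adding the
  -- vertices of the cycle one by one along a path, then closing the cycle,
  -- then attaching the pendant path.
  revLollipop : (n g : ℕ) → Graph n
  revLollipop n g i j = lolAdjℕ g (n ∸ suc (toℕ i)) (n ∸ suc (toℕ j))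

  ≡ᵇ-refl : ∀ n → (n ≡ᵇ n) ≡ true
  ≡ᵇ-refl zero = refl
  ≡ᵇ-refl (suc n) = ≡ᵇ-refl n

  ≡ᵇ-< : ∀ {y z} → y < z → (y ≡ᵇ z) ≡ false
  ≡ᵇ-< {zero} {suc z} _ = refl
  ≡ᵇ-< {suc y} {suc z} (s≤s p) = ≡ᵇ-< p

  ≡ᵇ-> : ∀ {y z} → y < z → (z ≡ᵇ y) ≡ false
  ≡ᵇ-> {zero} {suc z} _ = refl
  ≡ᵇ-> {suc y} {suc z} (s≤s p) = ≡ᵇ-> p

  -- Neighbours of the new vertex zero of revLollipop (suc (suc m)) g among the
  -- old vertices: the previous vertex, and the last one if the cycle closes now.
  newNbrs : ∀ {m} → ℕ → Mark (suc m)
  newNbrs {m} g j = isZero j ∨ (isLast j ∧ (suc m ≡ᵇ (g ∸ 1)))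

  new-vs-old : ∀ {m} (j : Fin (suc m)) → (suc (suc m) ≡ᵇ (m ∸ toℕ j)) ≡ false
  new-vs-old {m} j = ≡ᵇ-> (s≤s (≤-trans (m∸n≤m m (toℕ j)) (n≤1+n m)))

  old-is-previous : ∀ {m} (j : Fin (suc m)) → ((m ∸ toℕ j) ≡ᵇ m) ≡ isZero j
  old-is-previous {m} zero = ≡ᵇ-refl m
  old-is-previous {suc m} (suc j) = ≡ᵇ-< (s≤s (m∸n≤m m (toℕ j)))

  old-is-first : ∀ {m} (j : Fin (suc m)) → ((m ∸ toℕ j) ≡ᵇ 0) ≡ isLast j
  old-is-first {zero} zero = refl
  old-is-first {suc m} zero = refl
  old-is-first {suc m} (suc j) = old-is-first j

  module _ {m : ℕ} (g : ℕ) where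

    rev-new-old : ∀ j → revLollipop (suc (suc m)) g zero (suc j) ≡ newNbrs g j
    rev-new-old j rewrite new-vs-old j | old-is-previous j | old-is-first j = refl

    rev-old-new : ∀ j → revLollipop (suc (suc m)) g (suc j) zero ≡ newNbrs g j
    rev-old-new j rewrite new-vs-old j | old-is-previous j | old-is-first j = cong (isZero j ∨_) (∨-identityʳ _)

  -- No loop at the new vertex (the cycle has length at least 3).
  rev-loopless : ∀ n h → revLollipop (suc n) (suc (suc (suc h))) zero zero ≡ false
  rev-loopless zero h = refl
  rev-loopless (suc n) h rewrite ≡ᵇ-> {n} {suc n} ≤-refl = refl

  pendant-nbrs : ∀ {m} g → (suc m ≡ᵇ (g ∸ 1)) ≡ false → ∀ (j : Fin (suc m)) → newNbrs g j ≡ true → j ≡ zero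
  pendant-nbrs g not-closing j e rewrite not-closing | ∧-zeroʳ (isLast j) | ∨-identityʳ (isZero j) = isZero-≡ e

  closing-nbrs : ∀ {m} g → (suc m ≡ᵇ (g ∸ 1)) ≡ true → ∀ (j : Fin (suc m)) → newNbrs g j ≡ true →
                 (j ≡ zero) ⊎ (isLast j ≡ true)
  closing-nbrs g closes j e rewrite closes | ∧-identityʳ (isLast j) with ∪-split isZero isLast j e
  ... | inj₁ j≡0 = inj₁ (isZero-≡ j≡0)
  ... | inj₂ last = inj₂ last

  closing-last : ∀ {m} g → (suc m ≡ᵇ (g ∸ 1)) ≡ true → ∀ (j : Fin (suc m)) → isLast j ≡ true → newNbrs g j ≡ true
  closing-last g closes j last rewrite closes | ∧-identityʳ (isLast j) = ∪-introʳ isZero isLast j last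

  tri : ℕ → ℕ
  tri zero = zero
  tri (suc n) = suc n + tri n

  module LollipopCounts (h : ℕ) where

    g : ℕ
    g = suc (suc (suc h))

    R : (n : ℕ) → Graph n
    R n = revLollipop n g

    -- The counts carried along while the first n+1 cycle vertices form a path
    -- (vertex zero being its newest end, the last vertex its first one).
    record PathCounts (n : ℕ) : Set where
      field
        through-new : Count (Rooted (R (suc n)) isZero ∅) (suc n)
        through-first : Count (Rooted (R (suc n)) isLast ∅) (suc n)
        first-with-new : Count (Rooted (R (suc n)) isLast isZero) 1
        from-ends : Count (Rooted (R (suc n)) (isLast ∪ isZero) ∅) (suc (tri n))
        connected : CoreIndex (R (suc n)) (tri (suc n))

    path-start : PathCounts 0
    path-start = record
      { through-new = single
      ; through-first = single
      ; first-with-new = count-single-root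
      ; from-ends = count-rooted-cong (λ { zero → refl }) (λ _ → refl) single
      ; connected = count-connected count-connected-none single
      }
      where
      open SingleVertex (R 0) (R 1) (rev-loopless 0 h)
      open ExtensionCounts (R 0) (R 1) (λ ()) (λ ()) (rev-loopless 0 h) (λ ()) (λ ())
      single : Count (Rooted (R 1) isZero ∅) 1
      single = count-rooted-cong (λ _ → refl) (λ x → sym (∅-◂ x)) count-single-root

    path-step : ∀ n → n < suc h → PathCounts n → PathCounts (suc n)
    path-step n n<h+1 counts = record
      { through-new = through-new′
      ; through-first = subst (Count _) (+-comm (suc n) 1)
                          (count-rooted-cong (λ _ → refl) (λ x → sym (∅-◂ x)) (count-pendant-free through-first first-with-new))
      ; first-with-new = count-pendant-marked first-with-new
      ; from-ends = subst (Count _) (+-suc (suc n) (tri n))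
                      (count-rooted-cong ends-◂ (λ x → sym (∅-◂ x)) (count-pendant-root through-first from-ends))
      ; connected = subst (CoreIndex _) (+-comm (tri (suc n)) (suc (suc n))) (count-connected connected through-new′)
      }
      where
      open PathCounts counts
      not-closing : (suc n ≡ᵇ (g ∸ 1)) ≡ false
      not-closing = ≡ᵇ-< (s≤s n<h+1)
      open ExtensionCounts (R (suc n)) (R (suc (suc n))) (newNbrs g) (λ _ _ → refl) (rev-loopless (suc n) h)
                           (rev-new-old g) (rev-old-new g)
      open PendantCounts (R (suc n)) (R (suc (suc n))) (newNbrs g) (λ _ _ → refl) (rev-loopless (suc n) h)
                         (rev-new-old g) (rev-old-new g) (pendant-nbrs g not-closing) refl
      through-new′ : Count (Rooted (R (suc (suc n))) isZero ∅) (suc (suc n))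
      through-new′ = count-rooted-cong (λ _ → refl) (λ x → sym (∅-◂ x)) (count-pendant-root count-rootless through-new)
      ends-◂ : ∀ (x : Fin (suc (suc n))) → (true ◂ isLast) x ≡ (isLast ∪ isZero) x
      ends-◂ zero = refl
      ends-◂ (suc x) = sym (∨-identityʳ (isLast x))

    path-counts : ∀ n → n ≤ suc h → PathCounts n
    path-counts zero _ = path-start
    path-counts (suc n) (s≤s n≤h) = path-step n (s≤s n≤h) (path-counts n (≤-trans n≤h (n≤1+n h)))

    -- Connected subgraphs of the cycle C_g through a fixed vertex.
    cycleRooted : ℕ
    cycleRooted = 1 + (suc (suc h) + (suc (suc h) + suc (tri (suc h))))

    cycle-counts : Count (Rooted (R g) isZero ∅) cycleRooted × CoreIndex (R g) (tri (suc (suc h)) + cycleRooted)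
    cycle-counts = through-new′ , count-connected connected through-new′
      where
      open PathCounts (path-counts (suc h) ≤-refl)
      open ExtensionCounts (R (suc (suc h))) (R g) (newNbrs g) (λ _ _ → refl) (rev-loopless (suc (suc h)) h)
                           (rev-new-old g) (rev-old-new g)
      open ChordCounts (R (suc (suc h))) (R g) (newNbrs g) (λ _ _ → refl) (rev-loopless (suc (suc h)) h)
                       (rev-new-old g) (rev-old-new g) (closing-nbrs g (≡ᵇ-refl (suc (suc h)))) refl
                       (closing-last g (≡ᵇ-refl (suc (suc h))))
      through-new′ : Count (Rooted (R g) isZero ∅) cycleRooted
      through-new′ = count-rooted-cong (λ _ → refl) (λ x → sym (∅-◂ x))
                       (count-chord-root count-rootless through-new through-first from-ends)

    -- The core index of the lollipop with cycle length g and a pendant path of k edges.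
    lollipopF : ℕ → ℕ
    lollipopF zero = tri (suc (suc h)) + cycleRooted
    lollipopF (suc k) = lollipopF k + (cycleRooted + suc k)

    size : ℕ → ℕ
    size k = suc (suc (suc (k + h)))

    tail-counts : ∀ k → Count (Rooted (R (size k)) isZero ∅) (cycleRooted + k) × CoreIndex (R (size k)) (lollipopF k)
    tail-counts zero = subst (Count _) (sym (+-identityʳ cycleRooted)) (proj₁ cycle-counts) , proj₂ cycle-counts
    tail-counts (suc k) = through-new′ , count-connected (proj₂ (tail-counts k)) through-new′
      where
      not-closing : (size k ≡ᵇ (g ∸ 1)) ≡ false
      not-closing = ≡ᵇ-> (s≤s (s≤s (s≤s (m≤n+m h k))))
      open ExtensionCounts (R (size k)) (R (size (suc k))) (newNbrs g) (λ _ _ → refl) (rev-loopless (size k) h)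
                           (rev-new-old g) (rev-old-new g)
      open PendantCounts (R (size k)) (R (size (suc k))) (newNbrs g) (λ _ _ → refl) (rev-loopless (size k) h)
                         (rev-new-old g) (rev-old-new g) (pendant-nbrs g not-closing) refl
      through-new′ : Count (Rooted (R (size (suc k))) isZero ∅) (cycleRooted + suc k)
      through-new′ = subst (Count _) (sym (+-suc cycleRooted k)) (count-rooted-cong (λ _ → refl) (λ x → sym (∅-◂ x))
                       (count-pendant-root count-rootless (proj₁ (tail-counts k))))

    revLollipop-count : ∀ k → CoreIndex (R (size k)) (lollipopF k)
    revLollipop-count k = proj₂ (tail-counts k)

module Arithmetic where

  open Lollipop using (tri; module LollipopCounts)
  open import Data.Nat using (ℕ; zero; suc; _+_; _*_)
  open import Data.Nat.Properties using (*-distribˡ-+; *-distribʳ-+; *-comm)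
  open import Data.Nat.Tactic.RingSolver using (solve-∀)
  open import Relation.Binary.PropositionalEquality using (_≡_; refl; sym; cong; cong₂; module ≡-Reasoning)

  open LollipopCounts using (cycleRooted; lollipopF)
  open ≡-Reasoning

  tri-closed : ∀ x → 2 * tri x ≡ x * suc x
  tri-closed zero = refl
  tri-closed (suc x) = begin
    2 * (suc x + tri x)      ≡⟨ *-distribˡ-+ 2 (suc x) (tri x) ⟩
    2 * suc x + 2 * tri x    ≡⟨ cong (2 * suc x +_) (tri-closed x) ⟩
    2 * suc x + x * suc x    ≡⟨ sym (*-distribʳ-+ (suc x) 2 x) ⟩
    suc (suc x) * suc x      ≡⟨ *-comm (suc (suc x)) (suc x) ⟩
    suc x * suc (suc x)      ∎

  cycleRooted-closed : ∀ h → 2 * cycleRooted h ≡ (3 + h) * (3 + h) + (3 + h) + 2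
  cycleRooted-closed h = begin
    2 * cycleRooted h                                  ≡⟨ expand h (tri (suc h)) ⟩
    (4 * h + 12) + 2 * tri (suc h)                     ≡⟨ cong ((4 * h + 12) +_) (tri-closed (suc h)) ⟩
    (4 * h + 12) + suc h * suc (suc h)                 ≡⟨ collect h ⟩
    (3 + h) * (3 + h) + (3 + h) + 2                    ∎
    where
    expand : ∀ h t → 2 * (1 + (suc (suc h) + (suc (suc h) + suc t))) ≡ (4 * h + 12) + 2 * t
    expand = solve-∀
    collect : ∀ h → (4 * h + 12) + suc h * suc (suc h) ≡ (3 + h) * (3 + h) + (3 + h) + 2
    collect = solve-∀

  -- Twice the core index of the lollipop with cycle length g = h + 3 and k
  -- pendant edges (so n = g + k):  g(g-1) + k(k+1) + (k+1)(g² + g + 2).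
  closedF : ℕ → ℕ → ℕ
  closedF h k = (3 + h) * (2 + h) + k * suc k + suc k * ((3 + h) * (3 + h) + (3 + h) + 2)

  lollipopF-closed : ∀ h k → 2 * lollipopF h k ≡ closedF h k
  lollipopF-closed h zero = begin
    2 * (tri (suc (suc h)) + cycleRooted h)            ≡⟨ *-distribˡ-+ 2 (tri (suc (suc h))) (cycleRooted h) ⟩
    2 * tri (suc (suc h)) + 2 * cycleRooted h          ≡⟨ cong₂ _+_ (tri-closed (suc (suc h))) (cycleRooted-closed h) ⟩
    suc (suc h) * suc (suc (suc h)) + ((3 + h) * (3 + h) + (3 + h) + 2) ≡⟨ collect h ⟩
    closedF h zero                                     ∎
    where
    collect : ∀ h → suc (suc h) * suc (suc (suc h)) + ((3 + h) * (3 + h) + (3 + h) + 2) ≡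
                    (3 + h) * (2 + h) + 0 * 1 + 1 * ((3 + h) * (3 + h) + (3 + h) + 2)
    collect = solve-∀
  lollipopF-closed h (suc k) = begin
    2 * (lollipopF h k + (cycleRooted h + suc k))      ≡⟨ expand (lollipopF h k) (cycleRooted h) k ⟩
    2 * lollipopF h k + 2 * cycleRooted h + 2 * suc k  ≡⟨ cong₂ (λ a b → a + b + 2 * suc k) (lollipopF-closed h k) (cycleRooted-closed h) ⟩
    closedF h k + ((3 + h) * (3 + h) + (3 + h) + 2) + 2 * suc k ≡⟨ collect h k ⟩
    closedF h (suc k)                                  ∎
    where
    expand : ∀ F c k → 2 * (F + (c + suc k)) ≡ 2 * F + 2 * c + 2 * suc k
    expand = solve-∀
    collect : ∀ h k → (3 + h) * (2 + h) + k * suc k + suc k * ((3 + h) * (3 + h) + (3 + h) + 2) +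
                      ((3 + h) * (3 + h) + (3 + h) + 2) + 2 * suc k ≡
                      (3 + h) * (2 + h) + suc k * suc (suc k) + suc (suc k) * ((3 + h) * (3 + h) + (3 + h) + 2)
    collect = solve-∀

  -- Moving one vertex from the pendant path into the cycle (n fixed, g = h + 3
  -- becomes g + 1) changes twice the core index by (2gn + g) - (3g² + 2).
  exchange : ∀ h k → 2 * lollipopF (suc h) (suc k) + (3 * (3 + h) * (3 + h) + 2) ≡
                     2 * lollipopF h (suc (suc k)) + (2 * (3 + h) * (4 + (k + suc h)) + (3 + h))
  exchange h k = begin
    2 * lollipopF (suc h) (suc k) + (3 * (3 + h) * (3 + h) + 2)
      ≡⟨ cong (_+ (3 * (3 + h) * (3 + h) + 2)) (lollipopF-closed (suc h) (suc k)) ⟩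
    closedF (suc h) (suc k) + (3 * (3 + h) * (3 + h) + 2)
      ≡⟨ collect h k ⟩
    closedF h (suc (suc k)) + (2 * (3 + h) * (4 + (k + suc h)) + (3 + h))
      ≡⟨ cong (_+ (2 * (3 + h) * (4 + (k + suc h)) + (3 + h))) (sym (lollipopF-closed h (suc (suc k)))) ⟩
    2 * lollipopF h (suc (suc k)) + (2 * (3 + h) * (4 + (k + suc h)) + (3 + h)) ∎
    where
    collect : ∀ h k → (3 + (suc h)) * (2 + (suc h)) + (suc k) * suc (suc k) + suc (suc k) * ((3 + (suc h)) * (3 + (suc h)) + (3 + (suc h)) + 2) + (3 * (3 + h) * (3 + h) + 2) ≡
                      (3 + h) * (2 + h) + (suc (suc k)) * suc (suc (suc k)) + suc (suc (suc k)) * ((3 + h) * (3 + h) + (3 + h) + 2) + (2 * (3 + h) * (4 + (k + suc h)) + (3 + h))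
    collect = solve-∀

  extremes : ∀ U → 2 * lollipopF U 1 ≡ 2 * lollipopF 0 (suc U) + 2 * U * suc U
  extremes U = begin
    2 * lollipopF U 1                                  ≡⟨ lollipopF-closed U 1 ⟩
    closedF U 1                                        ≡⟨ collect U ⟩
    closedF 0 (suc U) + 2 * U * suc U                  ≡⟨ cong (_+ 2 * U * suc U) (sym (lollipopF-closed 0 (suc U))) ⟩
    2 * lollipopF 0 (suc U) + 2 * U * suc U            ∎
    where
    collect : ∀ U → (3 + U) * (2 + U) + 1 * suc 1 + suc 1 * ((3 + U) * (3 + U) + (3 + U) + 2) ≡ (3 + 0) * (2 + 0) + (suc U) * suc (suc U) + suc (suc U) * ((3 + 0) * (3 + 0) + (3 + 0) + 2) + 2 * U * suc U
    collect = solve-∀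

module Threshold where

  open import Data.Nat using (ℕ; zero; suc; _+_; _*_; _∸_; _≤_; _<_; z≤n; s≤s; _≤?_)
  open import Data.Nat.Properties
  open import Data.Nat.Divisibility using (_∣_; ∣m+n∣m⇒∣n; m∣m*n; ∣⇒≤)
  open import Data.Nat.Tactic.RingSolver using (solve-∀)
  open import Data.Sum using (inj₁; inj₂)
  open import Data.Empty using (⊥-elim)
  open import Relation.Nullary using (yes; no; ¬_)
  open import Relation.Binary.PropositionalEquality using (_≡_; _≢_; refl; sym; trans; cong; subst; subst₂)

  Below : ℕ → ℕ → Set
  Below n g = 3 * g * g + 2 < 2 * g * n + g

  -- The inequality is never tight for g ≥ 3: equality would force g ∣ 2.
  never-tight : ∀ n g → 3 ≤ g → 3 * g * g + 2 ≢ 2 * g * n + g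
  never-tight n g 3≤g tight = <⇒≱ 3≤g (∣⇒≤ g∣2)
    where
    g∣lhs : g ∣ 3 * g * g + 2
    g∣lhs = subst (g ∣_) (trans (factor g n) (sym tight)) (m∣m*n (2 * n + 1))
      where
      factor : ∀ g n → g * (2 * n + 1) ≡ 2 * g * n + g
      factor = solve-∀
    g∣2 : g ∣ 2
    g∣2 = ∣m+n∣m⇒∣n g∣lhs (subst (g ∣_) (*-comm g (3 * g)) (m∣m*n (3 * g)))

  not-below : ∀ n g → 3 ≤ g → ¬ Below n g → 2 * g * n + g < 3 * g * g + 2
  not-below n g 3≤g ¬below with m≤n⇒m<n∨m≡n (≮⇒≥ ¬below)
  ... | inj₁ lt = lt
  ... | inj₂ eq = ⊥-elim (never-tight n g 3≤g (sym eq))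

  -- The inequality is inherited by smaller g ≥ 1 (so the g satisfying it form
  -- an initial segment, ending at g₀).
  below-step-down : ∀ n g → 1 ≤ g → Below n (suc g) → Below n g
  below-step-down n g 1≤g below with suc (3 * g + 2) ≤? 2 * n
  ... | yes 3g+3≤2n = begin-strict
    3 * g * g + 2              <⟨ +-monoʳ-< (3 * g * g) (<-≤-trans (s≤s (s≤s (s≤s z≤n))) (*-monoʳ-≤ 4 1≤g)) ⟩
    3 * g * g + 4 * g          ≡⟨ expand g ⟩
    g * suc (3 * g + 2) + g    ≤⟨ +-monoˡ-≤ g (*-monoʳ-≤ g 3g+3≤2n) ⟩
    g * (2 * n) + g            ≡⟨ regroup g n ⟩
    2 * g * n + g              ∎
    where
    open ≤-Reasoning
    expand : ∀ g → 3 * g * g + 4 * g ≡ g * suc (3 * g + 2) + g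
    expand = solve-∀
    regroup : ∀ g n → g * (2 * n) + g ≡ 2 * g * n + g
    regroup = solve-∀
  ... | no 3g+3≰2n = ⊥-elim (<⇒≱ below (begin
    2 * suc g * n + suc g      ≡⟨ regroup g n ⟩
    suc g * (2 * n) + suc g    ≤⟨ +-monoˡ-≤ (suc g) (*-monoʳ-≤ (suc g) (≤-pred (≰⇒> 3g+3≰2n))) ⟩
    suc g * (3 * g + 2) + suc g ≤⟨ m≤m+n _ 2 ⟩
    suc g * (3 * g + 2) + suc g + 2 ≡⟨ expand g ⟩
    3 * suc g * suc g + 2      ∎))
    where
    open ≤-Reasoning
    regroup : ∀ g n → 2 * suc g * n + suc g ≡ suc g * (2 * n) + suc g
    regroup = solve-∀
    expand : ∀ g → suc g * (3 * g + 2) + suc g + 2 ≡ 3 * suc g * suc g + 2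
    expand = solve-∀

  below-down : ∀ n {g g′} → 1 ≤ g → g ≤ g′ → Below n g′ → Below n g
  below-down n {g} 1≤g g≤g′ below with m≤n⇒m<n∨m≡n g≤g′
  ... | inj₂ refl = below
  ... | inj₁ (s≤s g≤g″) = below-down n 1≤g g≤g″ (below-step-down n _ (≤-trans 1≤g g≤g″) below)

  below-2 : ∀ U → Below (4 + U) 2
  below-2 U = subst (14 <_) (sym (expand U)) (m≤m+n 15 (4 * U + 3))
    where
    expand : ∀ U → 2 * 2 * (4 + U) + 2 ≡ 15 + (4 * U + 3)
    expand = solve-∀

  below-bound : ∀ U g → Below (4 + U) g → g ≤ 2 + U
  below-bound U g below with g ≤? 2 + U
  ... | yes g≤U+2 = g≤U+2
  ... | no g≰U+2 = ⊥-elim (<⇒≱ below (subst (λ g → 2 * g * (4 + U) + g ≤ 3 * g * g + 2) g≡ (large U e)))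
    where
    e = g ∸ (3 + U)
    g≡ : (3 + U) + e ≡ g
    g≡ = m+[n∸m]≡n (≰⇒> g≰U+2)
    expand : ∀ U e → 3 * (3 + U + e) * (3 + U + e) + 2 ≡ (2 * (3 + U + e) * (4 + U) + (3 + U + e)) + ((3 + U + e) * (U + 3 * e) + 2)
    expand = solve-∀
    large : ∀ U e → 2 * (3 + U + e) * (4 + U) + (3 + U + e) ≤ 3 * (3 + U + e) * (3 + U + e) + 2
    large U e = subst (2 * (3 + U + e) * (4 + U) + (3 + U + e) ≤_) (sym (expand U e)) (m≤m+n _ _)

module Monotonicity where

  open import Data.Nat using (ℕ; zero; suc; _≤_; _<_; z≤n; s≤s; _≤?_)
  open import Data.Nat.Properties using (<-trans; <-irrefl; <⇒≤; ≤-refl; ≤-trans; n≤1+n; <-cmp; ≰⇒>; m≤n⇒m<n∨m≡n)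
  open import Data.Product using (_×_; _,_)
  open import Data.Sum using (inj₁; inj₂)
  open import Data.Empty using (⊥-elim)
  open import Relation.Nullary using (yes; no)
  open import Relation.Binary.Definitions using (tri<; tri≈; tri>)
  open import Relation.Binary.PropositionalEquality using (_≡_; refl)

  increasing-chain : (f : ℕ → ℕ) (p : ℕ) → (∀ i → i < p → f i < f (suc i)) → ∀ i j → i < j → j ≤ p → f i < f j
  increasing-chain f p up i (suc j) (s≤s i≤j) j<p with m≤n⇒m<n∨m≡n i≤j
  ... | inj₂ refl = up i j<p
  ... | inj₁ i<j = <-trans (increasing-chain f p up i j i<j (≤-trans (n≤1+n j) j<p)) (up j j<p)

  decreasing-chain : (f : ℕ → ℕ) (p U : ℕ) → (∀ i → p ≤ i → i < U → f (suc i) < f i) →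
                     ∀ i j → p ≤ i → i < j → j ≤ U → f j < f i
  decreasing-chain f p U down i (suc j) p≤i (s≤s i≤j) j<U with m≤n⇒m<n∨m≡n i≤j
  ... | inj₂ refl = down i p≤i j<U
  ... | inj₁ i<j = <-trans (down j (≤-trans p≤i (<⇒≤ i<j)) j<U) (decreasing-chain f p U down i j p≤i i<j (≤-trans (n≤1+n j) j<U))

  strictly : ∀ {a b} {A : Set} → a < b → (a ≤ b) × (a ≡ b → A)
  strictly a<b = <⇒≤ a<b , λ a≡b → ⊥-elim (<-irrefl a≡b a<b)

  module Unimodal (f : ℕ → ℕ) (p U : ℕ)
    (up : ∀ i → i < p → f i < f (suc i)) (down : ∀ i → p ≤ i → i < U → f (suc i) < f i) where

    unique-max : ∀ j → j ≤ U → (f j ≤ f p) × (f j ≡ f p → j ≡ p)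
    unique-max j j≤U with <-cmp j p
    ... | tri< j<p _ _ = strictly (increasing-chain f p up j p j<p ≤-refl)
    ... | tri≈ _ refl _ = ≤-refl , λ _ → refl
    ... | tri> _ _ p<j = strictly (decreasing-chain f p U down p j ≤-refl p<j j≤U)

    unique-min : (1 ≤ U → f 0 < f U) → ∀ j → j ≤ U → (f 0 ≤ f j) × (f 0 ≡ f j → j ≡ 0)
    unique-min ends zero _ = ≤-refl , λ _ → refl
    unique-min ends (suc j) j<U = strictly f0<fj
      where
      f0<fj : f 0 < f (suc j)
      f0<fj with suc j ≤? p
      ... | yes j<p = increasing-chain f p up 0 (suc j) (s≤s z≤n) j<p
      ... | no j≮p with m≤n⇒m<n∨m≡n j<U
      ...   | inj₂ refl = ends (s≤s z≤n)
      ...   | inj₁ j+1<U = <-trans (ends (≤-trans (s≤s z≤n) j<U))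
                                   (decreasing-chain f p U down (suc j) U (<⇒≤ (≰⇒> j≮p)) j+1<U ≤-refl)

open Counting
open Isomorphism
open Lollipop
open Arithmetic
open Threshold
open Monotonicity

-- Reversing the vertex order identifies revLollipop with the lollipop.
opposite-rev : ∀ {n} (i : Fin n) → n ∸ suc (toℕ (opposite i)) ≡ toℕ i
opposite-rev {suc n} i rewrite opposite-prop i = m∸[m∸n]≡n (toℕ≤pred[n] i)

coreIndex-lollipop : ∀ n g {k} → CoreIndex (revLollipop n g) k → CoreIndex (lollipop n g) k
coreIndex-lollipop n g = coreIndex-transfer (lollipop n g) (revLollipop n g) opposite opposite
  opposite-involutive opposite-involutive (λ i j → sym (cong₂ (lolAdjℕ g) (opposite-rev i) (opposite-rev j)))

∸-suc : ∀ U j → j < U → U ∸ j ≡ suc (U ∸ suc j)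
∸-suc (suc U) zero _ = refl
∸-suc (suc U) (suc j) (s≤s j<U) = ∸-suc U j j<U

doubled-compare : ∀ a b X Y → 2 * a + X ≡ 2 * b + Y → X < Y → b < a
doubled-compare a b X Y eq X<Y with b <? a
... | yes b<a = b<a
... | no b≮a = ⊥-elim (<-irrefl eq (+-mono-≤-< (*-monoʳ-≤ 2 (≮⇒≥ b≮a)) X<Y))

-- The core indices of the lollipops on n = U + 4 vertices, ψ j = F(U_{n,j+3}).
module Profile (U : ℕ) where

  n : ℕ
  n = 4 + U

  ψ : ℕ → ℕ
  ψ j = LollipopCounts.lollipopF j (suc (U ∸ j))

  -- U_{n,j+3} arises from the reversed lollipop with U + 1 - j pendant edges.
  coreIndex-ψ : ∀ j → j ≤ U → CoreIndex (lollipop n (3 + j)) (ψ j)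
  coreIndex-ψ j j≤U = coreIndex-lollipop n (3 + j)
    (subst (λ m → CoreIndex (revLollipop (3 + m) (3 + j)) (ψ j)) (cong suc (m∸n+n≡m j≤U))
           (LollipopCounts.revLollipop-count j (suc (U ∸ j))))

  ψ-exchange : ∀ j → j < U → 2 * ψ (suc j) + (3 * (3 + j) * (3 + j) + 2) ≡ 2 * ψ j + (2 * (3 + j) * n + (3 + j))
  ψ-exchange j j<U =
    trans (exchange j (U ∸ suc j))
          (cong₂ (λ k m → 2 * LollipopCounts.lollipopF j (suc k) + (2 * (3 + j) * (4 + m) + (3 + j)))
                 (sym (∸-suc U j j<U)) (m∸n+n≡m j<U))

  ψ-ends : 1 ≤ U → ψ 0 < ψ U
  ψ-ends 1≤U = subst (ψ 0 <_) (cong (λ k → LollipopCounts.lollipopF U (suc k)) (sym (n∸n≡0 U)))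
    (doubled-compare (LollipopCounts.lollipopF U 1) (ψ 0) 0 (2 * U * suc U) (trans (+-identityʳ _) (extremes U)) (positive 1≤U))
    where
    positive : 1 ≤ U → 0 < 2 * U * suc U
    positive (s≤s _) = s≤s z≤n

  -- With g₀ = p + 2, ψ rises while the cycle length j + 3 stays ≤ g₀ and
  -- falls afterwards; so U_{n,g₀+1} is the unique maximum and U_{n,3} the
  -- unique minimum.
  module Shape (p : ℕ) (p≤U : p ≤ U) (isG0 : IsG0 n (2 + p)) where

    rising : ∀ i → i < p → ψ i < ψ (suc i)
    rising i i<p = doubled-compare (ψ (suc i)) (ψ i) _ _ (ψ-exchange i (<-≤-trans i<p p≤U))
                     (below-down n (s≤s z≤n) (s≤s (s≤s i<p)) (proj₂ (proj₁ isG0)))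

    falling : ∀ i → p ≤ i → i < U → ψ (suc i) < ψ i
    falling i p≤i i<U = doubled-compare (ψ i) (ψ (suc i)) _ _ (sym (ψ-exchange i i<U))
                          (not-below n (3 + i) (s≤s (s≤s (s≤s z≤n))) above)
      where
      above : ¬ Below n (3 + i)
      above below with proj₂ isG0 (3 + i) (s≤s z≤n , below)
      ... | s≤s (s≤s i<p) = <-irrefl refl (≤-trans i<p p≤i)

    open Unimodal ψ p U rising falling public

g₀-range : ∀ U g₀ → IsG0 (4 + U) g₀ → ∃ λ p → g₀ ≡ 2 + p × p ≤ U
g₀-range U g₀ (below₀ , maximal) with maximal 2 (s≤s z≤n , below-2 U) | below-bound U g₀ (proj₂ below₀)
... | s≤s (s≤s {n = p} _) | s≤s (s≤s p≤U) = p , refl , p≤U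

same-count⇔≅ : ∀ {n g e x y} {G : Graph n} → G ≅ lollipop n g → CoreIndex G x → CoreIndex (lollipop n e) y →
               (x ≡ y → g ≡ e) → (x ≡ y) ⇔ (G ≅ lollipop n e)
same-count⇔≅ {n} {G = G} G≅ cG cL forces =
  mk⇔ (λ x≡y → subst (λ g → G ≅ lollipop n g) (forces x≡y) G≅) (λ G≅L → count-unique cG (coreIndex-≅ G≅L cL))

≡-sym-⇔ : ∀ {x y : ℕ} {P : Set} → (x ≡ y) ⇔ P → (y ≡ x) ⇔ P
≡-sym-⇔ x≡y⇔P = mk⇔ (λ y≡x → Equivalence.to x≡y⇔P (sym y≡x)) (λ p → sym (Equivalence.from x≡y⇔P p))

theorem4p10 : (n : ℕ) → 4 ≤ n → (g₀ : ℕ) → IsG0 n g₀ →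
  (G : Graph n) → (g : ℕ) → 3 ≤ g → g < n → G ≅ lollipop n g →
  Σ ℕ λ a → Σ ℕ λ b → Σ ℕ λ c →
    CoreIndex (lollipop n 3) a × CoreIndex G b × CoreIndex (lollipop n (suc g₀)) c ×
    a ≤ b × b ≤ c ×
    ((a ≡ b) ⇔ (G ≅ lollipop n 3)) ×
    ((b ≡ c) ⇔ (G ≅ lollipop n (suc g₀)))
theorem4p10 (suc (suc (suc (suc U)))) (s≤s (s≤s (s≤s (s≤s z≤n)))) g₀ isG0 G (suc (suc (suc j)))
            (s≤s (s≤s (s≤s z≤n))) (s≤s (s≤s (s≤s (s≤s j≤U)))) G≅ with g₀-range U g₀ isG0
... | p , refl , p≤U =
  ψ 0 , ψ j , ψ p , c-min , c-G , c-max ,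
  proj₁ (unique-min ψ-ends j j≤U) , proj₁ (unique-max j j≤U) ,
  ≡-sym-⇔ (same-count⇔≅ G≅ c-G c-min (λ e → cong (3 +_) (proj₂ (unique-min ψ-ends j j≤U) (sym e)))) ,
  same-count⇔≅ G≅ c-G c-max (λ e → cong (3 +_) (proj₂ (unique-max j j≤U) e))
  where
  open Profile U
  open Shape p p≤U isG0
  c-min : CoreIndex (lollipop n 3) (ψ 0)
  c-min = coreIndex-ψ 0 z≤n
  c-G : CoreIndex G (ψ j)
  c-G = coreIndex-≅ G≅ (coreIndex-ψ j j≤U)
  c-max : CoreIndex (lollipop n (3 + p)) (ψ p)
  c-max = coreIndex-ψ p p≤U
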